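{- Let $p$ be an odd prime, $m\ge1$, $q=p^m$, and let $\gamma_1,\gamma_2\in GF(q^2)\setminus\{0\}$ with $\gamma_1\bar\gamma_2-\bar\gamma_1\gamma_2\neq0$ (so $B^2_{(\gamma_1,0)}$ and $B^2_{(\gamma_2,0)}$ are distinct circles of the second type intersecting in $0$ and $\infty$). If $\gamma_1\gamma_2$ is a square in $GF(q^2)$, there are exactly $2(q-1)$ circles of the first type tangent to both $B^2_{(\gamma_1,0)}$ and $B^2_{(\gamma_2,0)}$. If $\gamma_1\gamma_2$ is a nonsquare in $GF(q^2)$, then $B^2_{(\gamma_1,0)}$ and $B^2_{(\gamma_2,0)}$ have no common tangent circles.
   Context: $GF(q^2)$ is the quadratic extension of $GF(q)$ and $\bar z:=z^q$. The plane $\mathbb M(q)$ has point set $GF(q^2)\cup\{\infty\}$; its circles are $B^1_{(c,r)}=\{z\in GF(q^2):(z-c)(\bar z-\bar c)=r\}$ ($c\in GF(q^2)$, $r\in GF(q)\setminus\{0\}$; first type) and $B^2_{(c,r)}=\{z\in GF(q^2):\bar c z+c\bar z=r\}\cup\{\infty\}$ ($c\in GF(q^2)\setminus\{0\}$, $r\in GF(q)$; second type). Two distinct circles are tangent if they have exactly one common point. -}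

module Defs where

open import Level using (Level; _⊔_; suc)
open import Algebra.Bundles using (CommutativeRing)
open import Data.Nat using (ℕ; zero; suc)
open import Data.List using (List; length)
open import Relation.Binary.PropositionalEquality using (_≡_)
open import Data.List.Relation.Unary.Any using (Any)
open import Data.List.Relation.Unary.All using (All)
open import Data.List.Relation.Unary.AllPairs using (AllPairs)
open import Data.Maybe using (Maybe; just; nothing)
open import Data.Product using (Σ; _×_; ∃)
open import Data.Unit.Polymorphic using (⊤)
open import Data.Empty.Polymorphic using (⊥)
open import Relation.Nullary using (¬_; Dec)

record FiniteField (c ℓ : Level) : Set (Level.suc (c ⊔ ℓ)) where
  field
    commRing : CommutativeRing c ℓ
  open CommutativeRing commRing public
  field
    _≟_      : (x y : Carrier) → Dec (x ≈ y)
    1≉0      : ¬ (1# ≈ 0#)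
    inverse  : (x : Carrier) → ¬ (x ≈ 0#) → Σ Carrier (λ y → x * y ≈ 1#)
    elems    : List Carrier
    complete : (x : Carrier) → Any (x ≈_) elems
    distinct : AllPairs (λ x y → ¬ (x ≈ y)) elems

module Plane {c ℓ : Level} (F : FiniteField c ℓ) (q : ℕ) where
  open FiniteField F

  pow : Carrier → ℕ → Carrier
  pow x zero    = 1#
  pow x (suc n) = x * pow x n

  conj : Carrier → Carrier
  conj z = pow z q

  InGFq : Carrier → Set ℓ
  InGFq r = pow r q ≈ r

  -- points of M(q): GF(q²) ∪ {∞}, with ∞ = nothing
  Point : Set c
  Point = Maybe Carrier

  _≈P_ : Point → Point → Set ℓ
  just x  ≈P just y  = x ≈ y
  nothing ≈P nothing = ⊤
  _       ≈P _       = ⊥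

  data Circle : Set (c ⊔ ℓ) where
    first  : (γ r : Carrier) → InGFq r → ¬ (r ≈ 0#) → Circle
    second : (γ r : Carrier) → ¬ (γ ≈ 0#) → InGFq r → Circle

  IsFirstType : Circle → Set (c ⊔ ℓ)
  IsFirstType (first _ _ _ _)  = ⊤
  IsFirstType (second _ _ _ _) = ⊥

  PointSet : Set (c ⊔ Level.suc ℓ)
  PointSet = Point → Set ℓ

  B¹ : Carrier → Carrier → PointSet
  B¹ γ r (just z) = (z - γ) * (conj z - conj γ) ≈ r
  B¹ γ r nothing  = ⊥

  B² : Carrier → Carrier → PointSet
  B² γ r (just z) = conj γ * z + γ * conj z ≈ r
  B² γ r nothing  = ⊤

  ⟦_⟧ : Circle → PointSet
  ⟦ first γ r _ _ ⟧  = B¹ γ r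
  ⟦ second γ r _ _ ⟧ = B² γ r

  SameSet : PointSet → PointSet → Set (c ⊔ ℓ)
  SameSet A B = (P : Point) → (A P → B P) × (B P → A P)

  SameCircle : Circle → Circle → Set (c ⊔ ℓ)
  SameCircle C D = SameSet ⟦ C ⟧ ⟦ D ⟧

  Tangent : PointSet → PointSet → Set (c ⊔ ℓ)
  Tangent A B =
    ¬ SameSet A B ×
    Σ Point (λ P → A P × B P ×
      ((Q : Point) → A Q → B Q → Q ≈P P))

  ExactlyCircles : ℕ → (Circle → Set (c ⊔ ℓ)) → Set (c ⊔ ℓ)
  ExactlyCircles n Φ =
    Σ (List Circle) λ L →
      length L ≡ n ×
      All Φ L ×
      AllPairs (λ C D → ¬ SameCircle C D) L ×
      ((C : Circle) → Φ C → Any (SameCircle C) L)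

  IsSquare : Carrier → Set (c ⊔ ℓ)
  IsSquare a = Σ Carrier (λ x → x * x ≈ a)

module Submission where

-- Put ε = γ₁ γ̄₂ - γ̄₁ γ₂, so that ε̄ = -ε. The finite points of the line B²(γ, 0) are the γ ε s with
-- s ∈ GF(q), and on it the equation of B¹(c, r) becomes a quadratic X(s)² = t² - 4 N r in s, where
-- N = γ γ̄ and t = γ c̄ + γ̄ c lie in GF(q); since 2 ≠ 0, the circle touches the line iff t² = 4 N r.
-- The values t₁, t₂ of t for the two lines determine the centre c, so common tangent circles correspond
-- to the (t₁, t₂, r) with t₁² = 4 N₁ r and t₂² = 4 N₂ r, i.e. r = t₂² / 4 N₂ with t₂ ∈ GF(q)* and
-- t₁² = (N₁ / N₂) t₂². If γ₁ γ₂ = y², then N₁ / N₂ = k² with k = y ȳ / N₂ ∈ GF(q), so t₁ = ± k t₂ and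
-- there are 2 (q - 1) circles. Otherwise such a circle would make N(γ₁ γ₂) = N₁ N₂ the square of some
-- λ ∈ GF(q)*, whence (γ₁ γ₂)^((q² - 1)/2) = λ^(q - 1) = 1, against Euler's criterion; and a line
-- B²(γ′, r′), which already meets both lines at ∞, could touch them only if parallel to both, forcing γ′ = 0.

open import Algebra.Bundles using (CommutativeRing; RawRing)
import Algebra.Solver.Ring.AlmostCommutativeRing as ACR
open import Data.Empty using (⊥; ⊥-elim)
open import Data.Fin as Fin using (Fin)
import Data.Fin.Properties as Fin
open import Data.Integer as ℤ using (ℤ; +_; -[1+_]; _⊖_; _◃_; sign; ∣_∣)
import Data.Integer.Properties as ℤ
open import Data.List using (List; []; _∷_; _++_; length; map; filter; foldr; cartesianProductWith)
import Data.List.Properties as List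
open import Data.List.Relation.Unary.All using (All)
import Data.List.Relation.Unary.All as All
import Data.List.Relation.Unary.All.Properties as All
open import Data.List.Relation.Unary.AllPairs using (AllPairs; []; _∷_; tail)
open import Data.List.Relation.Unary.Any using (Any; here; there)
import Data.List.Relation.Unary.Any as Any
import Data.List.Relation.Unary.Any.Properties as Any
open import Data.Maybe using (Maybe; just; nothing)
open import Data.Nat as ℕ using (ℕ; zero; suc; _∸_; _<_; s≤s; z≤n)
import Data.Nat.Properties as ℕ
open import Data.Nat.Divisibility using (_∣_; divides)
open import Data.Nat.Induction using (<-wellFounded)
open import Data.Nat.Primality using (Prime; ¬prime[0])
open import Data.Product using (∃; ∃₂; _×_; _,_; proj₁; proj₂; swap)
open import Data.Sign as Sign using (Sign)
open import Data.Sum using (_⊎_; inj₁; inj₂; [_,_])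
open import Data.Unit.Polymorphic using (tt)
open import Function using (id; _∘_)
open import Induction.WellFounded using (Acc; acc)
open import Level using (_⊔_; lower)
open import Relation.Binary.Bundles using (Setoid)
open import Relation.Binary.PropositionalEquality as ≡ using (_≡_)
open import Relation.Nullary using (¬_; Dec; yes; no)
open import Relation.Nullary.Decidable using (¬?; _×-dec_)

open import Defs

module IntegerCoefficients {a ℓ} (R : CommutativeRing a ℓ) where
  open CommutativeRing R
  open import Algebra.Properties.Semiring.Mult.TCOptimised semiring using (1+×; ×-homo-+; ×1-homo-*)
    renaming (_×_ to _×′_)
  open import Algebra.Properties.Ring ring using (-‿distribˡ-*; -‿distribʳ-*; -‿involutive; -0#≈0#)
  open import Algebra.Properties.AbelianGroup +-abelianGroup using (⁻¹-∙-comm)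
  open import Relation.Binary.Reasoning.Setoid setoid

  -- The optimised ×′ makes fromℕ 1 reduce to 1#, so the solver's constant 1 is literally 1#.
  fromℕ : ℕ → Carrier
  fromℕ n = n ×′ 1#

  fromℕ-suc : ∀ n → fromℕ (suc n) ≈ 1# + fromℕ n
  fromℕ-suc n = 1+× n 1#

  fromℤ : ℤ → Carrier
  fromℤ (+ n)    = fromℕ n
  fromℤ -[1+ n ] = - fromℕ (suc n)

  private
    signed : Sign → Carrier → Carrier
    signed Sign.+ x = x
    signed Sign.- x = - x

    signed-* : ∀ s t x y → signed (s Sign.* t) (x * y) ≈ signed s x * signed t y
    signed-* Sign.+ Sign.+ x y = refl
    signed-* Sign.+ Sign.- x y = -‿distribʳ-* x y
    signed-* Sign.- Sign.+ x y = -‿distribˡ-* x y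
    signed-* Sign.- Sign.- x y = begin
      x * y         ≈⟨ -‿involutive (x * y) ⟨
      - - (x * y)   ≈⟨ -‿cong (-‿distribˡ-* x y) ⟩
      - (- x * y)   ≈⟨ -‿distribʳ-* (- x) y ⟩
      - x * - y     ∎

    fromℤ-◃ : ∀ s n → fromℤ (s ◃ n) ≈ signed s (fromℕ n)
    fromℤ-◃ Sign.+ zero    = refl
    fromℤ-◃ Sign.- zero    = sym -0#≈0#
    fromℤ-◃ Sign.+ (suc n) = refl
    fromℤ-◃ Sign.- (suc n) = refl

    fromℤ-signAbs : ∀ i → fromℤ i ≈ signed (sign i) (fromℕ ∣ i ∣)
    fromℤ-signAbs (+ n)    = refl
    fromℤ-signAbs -[1+ n ] = refl

    [1+x]-[1+y]≈x-y : ∀ x y → (1# + x) - (1# + y) ≈ x - y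
    [1+x]-[1+y]≈x-y x y = begin
      (1# + x) - (1# + y)    ≈⟨ +-congˡ (⁻¹-∙-comm 1# y) ⟨
      (1# + x) + (- 1# - y)  ≈⟨ +-congʳ (+-comm 1# x) ⟩
      (x + 1#) + (- 1# - y)  ≈⟨ +-assoc x 1# _ ⟩
      x + (1# + (- 1# - y))  ≈⟨ +-congˡ (+-assoc 1# (- 1#) (- y)) ⟨
      x + ((1# - 1#) - y)    ≈⟨ +-congˡ (+-congʳ (-‿inverseʳ 1#)) ⟩
      x + (0# - y)           ≈⟨ +-congˡ (+-identityˡ (- y)) ⟩
      x - y                  ∎

    fromℤ-⊖ : ∀ m n → fromℤ (m ⊖ n) ≈ fromℕ m - fromℕ n
    fromℤ-⊖ zero    zero    = sym (-‿inverseʳ 0#)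
    fromℤ-⊖ (suc m) zero    = begin
      fromℕ (suc m)         ≈⟨ +-identityʳ _ ⟨
      fromℕ (suc m) + 0#    ≈⟨ +-congˡ -0#≈0# ⟨
      fromℕ (suc m) - 0#    ∎
    fromℤ-⊖ zero    (suc n) = sym (+-identityˡ _)
    fromℤ-⊖ (suc m) (suc n) = begin
      fromℤ (suc m ⊖ suc n)  ≡⟨ ≡.cong fromℤ (ℤ.[1+m]⊖[1+n]≡m⊖n m n) ⟩
      fromℤ (m ⊖ n)          ≈⟨ fromℤ-⊖ m n ⟩
      fromℕ m - fromℕ n      ≈⟨ [1+x]-[1+y]≈x-y (fromℕ m) (fromℕ n) ⟨
      (1# + fromℕ m) - (1# + fromℕ n) ≈⟨ +-cong (1+× m 1#) (-‿cong (1+× n 1#)) ⟨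
      fromℕ (suc m) - fromℕ (suc n) ∎

  fromℤ-+ : ∀ i j → fromℤ (i ℤ.+ j) ≈ fromℤ i + fromℤ j
  fromℤ-+ (+ m)    (+ n)    = ×-homo-+ 1# m n
  fromℤ-+ (+ m)    -[1+ n ] = fromℤ-⊖ m (suc n)
  fromℤ-+ -[1+ m ] (+ n)    = trans (fromℤ-⊖ n (suc m)) (+-comm _ _)
  fromℤ-+ -[1+ m ] -[1+ n ] = begin
    - fromℕ (suc (suc (m ℕ.+ n)))      ≈⟨ -‿cong (trans (1+× (suc m ℕ.+ n) 1#) (+-congˡ (×-homo-+ 1# (suc m) n))) ⟩
    - (1# + (fromℕ (suc m) + fromℕ n)) ≈⟨ -‿cong (+-assoc 1# _ _) ⟨
    - ((1# + fromℕ (suc m)) + fromℕ n) ≈⟨ -‿cong (+-congʳ (+-comm 1# _)) ⟩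
    - ((fromℕ (suc m) + 1#) + fromℕ n) ≈⟨ -‿cong (trans (+-assoc _ 1# _) (+-congˡ (sym (1+× n 1#)))) ⟩
    - (fromℕ (suc m) + fromℕ (suc n))  ≈⟨ ⁻¹-∙-comm _ _ ⟨
    - fromℕ (suc m) - fromℕ (suc n)    ∎

  fromℤ-* : ∀ i j → fromℤ (i ℤ.* j) ≈ fromℤ i * fromℤ j
  fromℤ-* i j = begin
    fromℤ (sign i Sign.* sign j ◃ ∣ i ∣ ℕ.* ∣ j ∣)           ≈⟨ fromℤ-◃ (sign i Sign.* sign j) (∣ i ∣ ℕ.* ∣ j ∣) ⟩
    signed (sign i Sign.* sign j) (fromℕ (∣ i ∣ ℕ.* ∣ j ∣))  ≈⟨ signed-cong (sign i Sign.* sign j) (×1-homo-* ∣ i ∣ ∣ j ∣) ⟩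
    signed (sign i Sign.* sign j) (fromℕ ∣ i ∣ * fromℕ ∣ j ∣) ≈⟨ signed-* (sign i) (sign j) (fromℕ ∣ i ∣) (fromℕ ∣ j ∣) ⟩
    signed (sign i) (fromℕ ∣ i ∣) * signed (sign j) (fromℕ ∣ j ∣) ≈⟨ *-cong (fromℤ-signAbs i) (fromℤ-signAbs j) ⟨
    fromℤ i * fromℤ j ∎
    where
    signed-cong : ∀ s {x y} → x ≈ y → signed s x ≈ signed s y
    signed-cong Sign.+ e = e
    signed-cong Sign.- e = -‿cong e

  fromℤ-neg : ∀ i → fromℤ (ℤ.- i) ≈ - fromℤ i
  fromℤ-neg (+ zero)  = sym -0#≈0#
  fromℤ-neg (+ suc n) = refl
  fromℤ-neg -[1+ n ]  = sym (-‿involutive _)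

  private
    ℤ-rawRing : RawRing _ _
    ℤ-rawRing = record
      { Carrier = ℤ ; _≈_ = _≡_ ; _+_ = ℤ._+_ ; _*_ = ℤ._*_ ; -_ = ℤ.-_ ; 0# = ℤ.0ℤ ; 1# = ℤ.1ℤ }

    fromℤ-morphism : ℤ-rawRing ACR.-Raw-AlmostCommutative⟶ ACR.fromCommutativeRing R
    fromℤ-morphism = record
      { ⟦_⟧ = fromℤ ; +-homo = fromℤ-+ ; *-homo = fromℤ-* ; -‿homo = fromℤ-neg
      ; 0-homo = refl ; 1-homo = refl }

    fromℤ-≟ : ∀ i j → Maybe (fromℤ i ≈ fromℤ j)
    fromℤ-≟ i j with i ℤ.≟ j
    ... | yes ≡.refl = just refl
    ... | no _       = nothing

  open import Algebra.Solver.Ring ℤ-rawRing (ACR.fromCommutativeRing R) fromℤ-morphism fromℤ-≟ public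
    using (solve; _:=_; _:+_; _:*_; _:-_; :-_; con; Polynomial)

  κ : ∀ {n} → ℕ → Polynomial n
  κ k = con (+ k)

length-cartesianProductWith : ∀ {a b c} {A : Set a} {B : Set b} {C : Set c} (f : A → B → C) xs ys →
  length (cartesianProductWith f xs ys) ≡ length xs ℕ.* length ys
length-cartesianProductWith f []       ys = ≡.refl
length-cartesianProductWith f (x ∷ xs) ys = ≡.trans (List.length-++ (map (f x) ys))
  (≡.cong₂ ℕ._+_ (List.length-map (f x) ys) (length-cartesianProductWith f xs ys))

module UniqueLists {a ℓ} (S : Setoid a ℓ) where
  open Setoid S renaming (Carrier to A)
  open import Data.List.Membership.Setoid S using (_∈_)
  open import Data.List.Membership.Setoid.Properties using (∈-∃++; ∈-resp-≈; ∈-map⁺; ∈-map⁻; ∈-cartesianProductWith⁻)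
  open import Data.List.Relation.Binary.Subset.Setoid S using (_⊆_)
  open import Data.List.Relation.Unary.Unique.Setoid S using (Unique)
  import Data.List.Relation.Unary.Unique.Setoid as UniqueT
  open import Data.List.Relation.Unary.Unique.Setoid.Properties using (Unique[x∷xs]⇒x∉xs; ++⁺; map⁺)
  open import Data.List.Relation.Binary.Permutation.Setoid S public using (_↭_; ↭-refl; ↭-sym; ↭-trans; ↭-reflexive-≋; prep)
  open import Data.List.Relation.Binary.Permutation.Setoid.Properties S public
    using (∈-resp-↭; Unique-resp-↭; xs↭ys⇒|xs|≡|ys|; shift; foldr-commMonoid)

  ∈⇒↭-∷ : ∀ {v xs} → v ∈ xs → ∃ λ rest → xs ↭ v ∷ rest
  ∈⇒↭-∷ v∈xs with ∈-∃++ S v∈xs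
  ... | ys , zs , _ , v≈w , xs≋ = ys ++ zs , ↭-trans (↭-reflexive-≋ xs≋) (shift (sym v≈w) ys zs)

  ∈-∷⁻ : ∀ {v x xs} → v ∈ x ∷ xs → ¬ v ≈ x → v ∈ xs
  ∈-∷⁻ (here v≈x)  v≉x = ⊥-elim (v≉x v≈x)
  ∈-∷⁻ (there v∈) _   = v∈

  Unique-⊆-⊇⇒↭ : ∀ {xs ys} → Unique xs → Unique ys → xs ⊆ ys → ys ⊆ xs → xs ↭ ys
  Unique-⊆-⊇⇒↭ {[]}     {[]}    _ _ _ _ = ↭-refl
  Unique-⊆-⊇⇒↭ {[]}     {_ ∷ _} _ _ _ ys⊆[] with ys⊆[] (here refl)
  ... | ()
  Unique-⊆-⊇⇒↭ {x ∷ xs} {ys} x∷xs!@(_ ∷ xs!) ys! xs⊆ys ys⊆xs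
    with rest , ys↭ ← ∈⇒↭-∷ (xs⊆ys (here refl)) =
    ↭-trans (prep refl (Unique-⊆-⊇⇒↭ xs! rest! xs⊆rest rest⊆xs)) (↭-sym ys↭)
    where
    x∷rest! : Unique (x ∷ rest)
    x∷rest! = Unique-resp-↭ ys↭ ys!
    rest! : Unique rest
    rest! = tail x∷rest!
    xs⊆rest : xs ⊆ rest
    xs⊆rest z∈xs = ∈-∷⁻ (∈-resp-↭ ys↭ (xs⊆ys (there z∈xs)))
                        (λ z≈x → Unique[x∷xs]⇒x∉xs S x∷xs! (∈-resp-≈ S z≈x z∈xs))
    rest⊆xs : rest ⊆ xs
    rest⊆xs z∈rest = ∈-∷⁻ (ys⊆xs (∈-resp-↭ (↭-sym ys↭) (there z∈rest)))
                          (λ z≈x → Unique[x∷xs]⇒x∉xs S x∷rest! (∈-resp-≈ S z≈x z∈rest))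

  Unique-map : ∀ {b ℓ₂} (T : Setoid b ℓ₂) (g : A → Setoid.Carrier T) {ys} → Unique ys →
               (∀ {y y′} → y ∈ ys → y′ ∈ ys → Setoid._≈_ T (g y) (g y′) → y ≈ y′) → UniqueT.Unique T (map g ys)
  Unique-map T g {[]}     _                 _   = []
  Unique-map T g {y ∷ ys} y∷ys!@(_ ∷ ys!) inj =
    All.map⁺ (All.tabulateₛ S λ y′∈ gy≈gy′ →
      Unique[x∷xs]⇒x∉xs S y∷ys! (∈-resp-≈ S (sym (inj (here refl) (there y′∈) gy≈gy′)) y′∈))
    ∷ Unique-map T g ys! (λ y∈ y′∈ → inj (there y∈) (there y′∈))

  Unique-cartesianProductWith : ∀ (f : A → A → A) {xs ys} → Unique xs → Unique ys →
    (∀ {a a′ b b′} → a ∈ xs → a′ ∈ xs → b ∈ ys → b′ ∈ ys → f a b ≈ f a′ b′ → a ≈ a′ × b ≈ b′) →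
    Unique (cartesianProductWith f xs ys)
  Unique-cartesianProductWith f {[]}     _                 _   _   = []
  Unique-cartesianProductWith f {x ∷ xs} {ys} x∷xs!@(_ ∷ xs!) ys! inj = ++⁺ S
    (Unique-map S (f x) ys! λ b∈ b′∈ e → proj₂ (inj (here refl) (here refl) b∈ b′∈ e))
    (Unique-cartesianProductWith f xs! ys! λ a∈ a′∈ → inj (there a∈) (there a′∈))
    disjoint
    where
    disjoint : ∀ {v} → ¬ (v ∈ map (f x) ys × v ∈ cartesianProductWith f xs ys)
    disjoint (v∈map , v∈prod) with ∈-map⁻ S S v∈map | ∈-cartesianProductWith⁻ S S S f xs ys v∈prod
    ... | b , b∈ , v≈fxb | a , b′ , a∈ , b′∈ , v≈fab′ =
      Unique[x∷xs]⇒x∉xs S x∷xs!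
        (∈-resp-≈ S (sym (proj₁ (inj (here refl) (there a∈) b∈ b′∈ (trans (sym v≈fxb) v≈fab′)))) a∈)

  map-↭ : ∀ {f : A → A} {xs} → (∀ {x y} → x ≈ y → f x ≈ f y) → (∀ {x y} → f x ≈ f y → x ≈ y) →
          Unique xs → (∀ {x} → x ∈ xs → f x ∈ xs) → (∀ {y} → y ∈ xs → ∃ λ x → x ∈ xs × y ≈ f x) →
          map f xs ↭ xs
  map-↭ {f} {xs} f-cong f-inj xs! into onto = Unique-⊆-⊇⇒↭ (map⁺ S S f-inj xs!) xs! map⊆ ⊇map
    where
    map⊆ : map f xs ⊆ xs
    map⊆ y∈ with x , x∈ , y≈fx ← ∈-map⁻ S S y∈ = ∈-resp-≈ S (sym y≈fx) (into x∈)
    ⊇map : xs ⊆ map f xs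
    ⊇map y∈ with x , x∈ , y≈fx ← onto y∈ = ∈-resp-≈ S (sym y≈fx) (∈-map⁺ S S f-cong x∈)

module NatLemmas where

  open import Data.Nat
  open import Data.Nat.Properties
  open import Data.Nat.Divisibility
  open import Data.Nat.Primality
  open import Data.Nat.Combinatorics
  open import Data.Nat.DivMod using (_%_; _/_; m*n/n≡m; m≡m%n+[m/n]*n; m%n<n)
  open import Data.Nat.Tactic.RingSolver using (solve-∀)
  open import Data.Product using (∃; _,_)
  open import Data.Sum using (inj₁; inj₂)
  open import Data.Empty using (⊥-elim)
  open import Relation.Binary.Definitions using (tri<; tri≈; tri>)
  open import Relation.Binary.PropositionalEquality
  open import Relation.Nullary using (¬_)

  prime∤! : ∀ {p} → Prime p → ∀ {j} → j < p → ¬ (p ∣ j !)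
  prime∤! {p} p-prime {zero} _ p∣1 =
    <⇒≱ (nonTrivial⇒n>1 p {{prime⇒nonTrivial p-prime}}) (∣⇒≤ p∣1)
  prime∤! p-prime {suc j} j<p p∣j! with euclidsLemma (suc j) (j !) p-prime p∣j!
  ... | inj₁ p∣1+j = <⇒≱ j<p (∣⇒≤ p∣1+j)
  ... | inj₂ p∣j!  = prime∤! p-prime (<-trans (n<1+n j) j<p) p∣j!

  nCk*k!*[n∸k]!≡n! : ∀ {n k} → k ≤ n → (n C k) * (k ! * (n ∸ k) !) ≡ n !
  nCk*k!*[n∸k]!≡n! {n} {k} k≤n with k![n∸k]!∣n! k≤n
  ... | divides q n!≡q*d = trans (cong (_* d) nCk≡q) (sym n!≡q*d)
    where
    d : ℕ
    d = k ! * (n ∸ k) !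
    instance
      d≢0 : NonZero d
      d≢0 = k !* (n ∸ k) !≢0
    nCk≡q : n C k ≡ q
    nCk≡q = trans (nCk≡n!/k![n-k]! k≤n) (trans (cong (_/ d) n!≡q*d) (m*n/n≡m q d))

  prime∣pCk : ∀ {p k} → Prime p → 0 < k → k < p → p ∣ p C k
  prime∣pCk {p} {k} p-prime 0<k k<p with euclidsLemma (p C k) (k ! * (p ∸ k) !) p-prime p∣product
    where
    p∣product : p ∣ (p C k) * (k ! * (p ∸ k) !)
    p∣product = subst (p ∣_) (sym (nCk*k!*[n∸k]!≡n! (<⇒≤ k<p))) (n∣n! (prime⇒nonZero p-prime))
      where
      n∣n! : ∀ {n} → NonZero n → n ∣ n !
      n∣n! {suc n} _ = m∣m*n (n !)
  ... | inj₁ p∣pCk = p∣pCk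
  ... | inj₂ p∣k!*[p∸k]! with euclidsLemma (k !) ((p ∸ k) !) p-prime p∣k!*[p∸k]!
  ...   | inj₁ p∣k!     = ⊥-elim (prime∤! p-prime k<p p∣k!)
  ...   | inj₂ p∣[p∸k]! = ⊥-elim (prime∤! p-prime (∸-monoʳ-< 0<k (<⇒≤ k<p)) p∣[p∸k]!)

  Odd : ℕ → Set
  Odd n = ∃ λ h → n ≡ suc (2 * h)

  odd-prime : ∀ {p} → Prime p → ¬ (p ≡ 2) → Odd p
  odd-prime {p} p-prime p≢2 with p % 2 in p%2≡r
  ... | 0 = ⊥-elim (Prime.notComposite p-prime (composite 2<p (divides (p / 2) p≡[p/2]*2)))
    where
    p≡[p/2]*2 : p ≡ p / 2 * 2
    p≡[p/2]*2 = trans (m≡m%n+[m/n]*n p 2) (cong (_+ p / 2 * 2) p%2≡r)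
    2<p : 2 < p
    2<p with nonTrivial⇒n>1 p {{prime⇒nonTrivial p-prime}}
    ... | s≤s (s≤s z≤n) with p
    ...   | suc (suc zero)    = ⊥-elim (p≢2 refl)
    ...   | suc (suc (suc _)) = s≤s (s≤s (s≤s z≤n))
  ... | 1 = p / 2 , trans (m≡m%n+[m/n]*n p 2) (trans (cong (_+ p / 2 * 2) p%2≡r) (cong suc (*-comm (p / 2) 2)))
  ... | suc (suc _) = ⊥-elim (<⇒≱ (m%n<n p 2) (subst (2 ≤_) (sym p%2≡r) (s≤s (s≤s z≤n))))

  odd-^ : ∀ {p} → Odd p → ∀ m → Odd (p ^ m)
  odd-^ _ zero = 0 , refl
  odd-^ {p} odd@(h , refl) (suc m) with odd-^ odd m
  ... | h′ , p^m≡ = h * h′ * 2 + h + h′ , trans (cong (suc (2 * h) *_) p^m≡) (product-of-odds h h′)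
    where
    product-of-odds : ∀ h h′ → suc (2 * h) * suc (2 * h′) ≡ suc (2 * (h * h′ * 2 + h + h′))
    product-of-odds = solve-∀

  odd-square : ∀ {n h} → n ≡ suc (2 * h) → n * n ≡ suc (2 * (suc n * h))
  odd-square {h = h} refl = square-of-odd h
    where
    square-of-odd : ∀ h → suc (2 * h) * suc (2 * h) ≡ suc (2 * (suc (suc (2 * h)) * h))
    square-of-odd = solve-∀

  *-self-injective : ∀ {a b} → a * a ≡ b * b → a ≡ b
  *-self-injective {a} {b} a²≡b² with <-cmp a b
  ... | tri< a<b _ _ = ⊥-elim (<-irrefl a²≡b² (*-mono-< a<b a<b))
  ... | tri≈ _ a≡b _ = a≡b
  ... | tri> _ _ b<a = ⊥-elim (<-irrefl (sym a²≡b²) (*-mono-< b<a b<a))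

open NatLemmas

module Frobenius {a ℓ} (R : CommutativeRing a ℓ) where
  open CommutativeRing R
  open import Data.Nat.Combinatorics using (nCn≡1)
  open import Algebra.Definitions.RawMonoid +-rawMonoid using (sum) renaming (_×_ to _·_)
  open import Algebra.Properties.Monoid.Mult +-monoid using (×-congʳ; ×-homo-1)
  open import Algebra.Properties.Semiring.Mult semiring using (×-assoc-*; ×1-homo-*)
  open import Algebra.Properties.Monoid.Sum +-monoid using (sum-init-last; sum-cong-≋; sum-replicate-zero)
  open import Algebra.Properties.Semiring.Exp semiring using (_^_)
  open import Algebra.Properties.CommutativeSemiring.Binomial commutativeSemiring
    using (theorem; binomialTerm)
  open import Relation.Binary.Reasoning.Setoid setoid

  ·-vanishes : ∀ {p n} → p · 1# ≈ 0# → p ∣ n → ∀ z → n · z ≈ 0#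
  ·-vanishes {p} char-p (divides t ≡.refl) z = begin
    (t ℕ.* p) · z                ≈⟨ ×-congʳ (t ℕ.* p) (*-identityˡ z) ⟨
    (t ℕ.* p) · (1# * z)         ≈⟨ ×-assoc-* (t ℕ.* p) 1# z ⟨
    ((t ℕ.* p) · 1#) * z         ≈⟨ *-congʳ (×1-homo-* t p) ⟩
    ((t · 1#) * (p · 1#)) * z    ≈⟨ *-congʳ (*-congˡ char-p) ⟩
    ((t · 1#) * 0#) * z          ≈⟨ *-congʳ (zeroʳ _) ⟩
    0# * z                       ≈⟨ zeroˡ z ⟩
    0#                           ∎

  frobenius : ∀ {p} → Prime p → p · 1# ≈ 0# → ∀ x y → (x + y) ^ p ≈ x ^ p + y ^ p
  frobenius {zero}  p-prime = ⊥-elim (¬prime[0] p-prime)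
  frobenius {suc n} p-prime char-p x y = begin
    (x + y) ^ p                                            ≈⟨ theorem p x y ⟩
    T Fin.zero + sum (λ i → T (Fin.suc i))                 ≈⟨ +-congˡ (sum-init-last (λ i → T (Fin.suc i))) ⟩
    T Fin.zero + (sum middle + T (Fin.suc (Fin.fromℕ n)))  ≈⟨ +-cong first (+-cong middle≈0 last) ⟩
    y ^ p + (0# + x ^ p)                                   ≈⟨ +-comm _ _ ⟩
    (0# + x ^ p) + y ^ p                                   ≈⟨ +-congʳ (+-identityˡ _) ⟩
    x ^ p + y ^ p                                          ∎
    where
    p : ℕ
    p = suc n
    T : Fin (suc p) → Carrier
    T = binomialTerm x y p
    middle : Fin n → Carrier
    middle i = T (Fin.suc (Fin.inject₁ i))
    first : T Fin.zero ≈ y ^ p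
    first = trans (×-homo-1 _) (*-identityˡ _)
    last : T (Fin.suc (Fin.fromℕ n)) ≈ x ^ p
    last rewrite Fin.toℕ-fromℕ n | nCn≡1 p | ℕ.n∸n≡0 n = trans (×-homo-1 _) (*-identityʳ _)
    middle≈0 : sum middle ≈ 0#
    middle≈0 = trans (sum-cong-≋ λ i → ·-vanishes char-p (prime∣pCk p-prime (s≤s z≤n) (k<p i)) _)
                     (sum-replicate-zero n)
      where
      k<p : ∀ i → suc (Fin.toℕ (Fin.inject₁ i)) < p
      k<p i rewrite Fin.toℕ-inject₁ i = s≤s (Fin.toℕ<n i)

module FieldLemmas {c ℓ} (F : FiniteField c ℓ) where
  open FiniteField F
  open IntegerCoefficients commRing
  open import Algebra.Properties.Ring ring using (-‿involutive; -0#≈0#)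
  open import Algebra.Properties.Group +-group using (∙-cancelʳ)
    renaming (x∙y⁻¹≈ε⇒x≈y to x-y≈0⇒x≈y; x≈y⇒x∙y⁻¹≈ε to x≈y⇒x-y≈0)
  open import Relation.Binary.Reasoning.Setoid setoid

  -- 0# ⁻¹ is the junk value 0#
  _⁻¹ : Carrier → Carrier
  x ⁻¹ with x ≟ 0#
  ... | yes _  = 0#
  ... | no x≉0 = proj₁ (inverse x x≉0)

  x*x⁻¹≈1 : ∀ {x} → x ≉ 0# → x * x ⁻¹ ≈ 1#
  x*x⁻¹≈1 {x} x≉0 with x ≟ 0#
  ... | yes x≈0 = ⊥-elim (x≉0 x≈0)
  ... | no x≉0′ = proj₂ (inverse x x≉0′)

  x⁻¹*x≈1 : ∀ {x} → x ≉ 0# → x ⁻¹ * x ≈ 1#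
  x⁻¹*x≈1 x≉0 = trans (*-comm _ _) (x*x⁻¹≈1 x≉0)

  *-cancelˡ : ∀ {x y z} → x ≉ 0# → x * y ≈ x * z → y ≈ z
  *-cancelˡ {x} {y} {z} x≉0 xy≈xz = begin
    y                ≈⟨ *-identityˡ y ⟨
    1# * y           ≈⟨ *-congʳ (x⁻¹*x≈1 x≉0) ⟨
    (x ⁻¹ * x) * y   ≈⟨ *-assoc _ _ _ ⟩
    x ⁻¹ * (x * y)   ≈⟨ *-congˡ xy≈xz ⟩
    x ⁻¹ * (x * z)   ≈⟨ *-assoc _ _ _ ⟨
    (x ⁻¹ * x) * z   ≈⟨ *-congʳ (x⁻¹*x≈1 x≉0) ⟩
    1# * z           ≈⟨ *-identityˡ z ⟩
    z                ∎

  x*y≈0⇒x≈0⊎y≈0 : ∀ {x y} → x * y ≈ 0# → x ≈ 0# ⊎ y ≈ 0#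
  x*y≈0⇒x≈0⊎y≈0 {x} {y} xy≈0 with x ≟ 0#
  ... | yes x≈0 = inj₁ x≈0
  ... | no x≉0  = inj₂ (*-cancelˡ x≉0 (trans xy≈0 (sym (zeroʳ x))))

  x*x≈0⇒x≈0 : ∀ {x} → x * x ≈ 0# → x ≈ 0#
  x*x≈0⇒x≈0 xx≈0 with x*y≈0⇒x≈0⊎y≈0 xx≈0
  ... | inj₁ x≈0 = x≈0
  ... | inj₂ x≈0 = x≈0

  *-≉0 : ∀ {x y} → x ≉ 0# → y ≉ 0# → x * y ≉ 0#
  *-≉0 x≉0 y≉0 xy≈0 with x*y≈0⇒x≈0⊎y≈0 xy≈0
  ... | inj₁ x≈0 = x≉0 x≈0
  ... | inj₂ y≈0 = y≉0 y≈0

  -‿≉0 : ∀ {x} → x ≉ 0# → - x ≉ 0#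
  -‿≉0 {x} x≉0 -x≈0 = x≉0 (trans (sym (-‿involutive x)) (trans (-‿cong -x≈0) -0#≈0#))

  ⁻¹-≉0 : ∀ {x} → x ≉ 0# → x ⁻¹ ≉ 0#
  ⁻¹-≉0 {x} x≉0 x⁻¹≈0 = 1≉0 (trans (sym (x*x⁻¹≈1 x≉0)) (trans (*-congˡ x⁻¹≈0) (zeroʳ x)))

  x*y≈1⇒y≈x⁻¹ : ∀ {x y} → x * y ≈ 1# → y ≈ x ⁻¹
  x*y≈1⇒y≈x⁻¹ {x} {y} xy≈1 = *-cancelˡ x≉0 (trans xy≈1 (sym (x*x⁻¹≈1 x≉0)))
    where
    x≉0 : x ≉ 0#
    x≉0 x≈0 = 1≉0 (trans (sym xy≈1) (trans (*-congʳ x≈0) (zeroˡ y)))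

  x≈0⇒x⁻¹≈0 : ∀ {x} → x ≈ 0# → x ⁻¹ ≈ 0#
  x≈0⇒x⁻¹≈0 {x} x≈0 with x ≟ 0#
  ... | yes _  = refl
  ... | no x≉0 = ⊥-elim (x≉0 x≈0)

  ⁻¹-cong : ∀ {x y} → x ≈ y → x ⁻¹ ≈ y ⁻¹
  ⁻¹-cong {x} {y} x≈y = cases (x ≟ 0#)
    where
    cases : Dec (x ≈ 0#) → x ⁻¹ ≈ y ⁻¹
    cases (yes x≈0) = trans (x≈0⇒x⁻¹≈0 x≈0) (sym (x≈0⇒x⁻¹≈0 (trans (sym x≈y) x≈0)))
    cases (no x≉0)  = x*y≈1⇒y≈x⁻¹ (trans (*-congʳ (sym x≈y)) (x*x⁻¹≈1 x≉0))

  ⁻¹-involutive : ∀ {x} → x ≉ 0# → x ⁻¹ ⁻¹ ≈ x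
  ⁻¹-involutive x≉0 = sym (x*y≈1⇒y≈x⁻¹ (x⁻¹*x≈1 x≉0))

  ⁻¹-distrib-* : ∀ {x y} → x ≉ 0# → y ≉ 0# → (x * y) ⁻¹ ≈ x ⁻¹ * y ⁻¹
  ⁻¹-distrib-* {x} {y} x≉0 y≉0 = sym (x*y≈1⇒y≈x⁻¹ (begin
    (x * y) * (x ⁻¹ * y ⁻¹)   ≈⟨ solve 4 (λ x y x′ y′ → (x :* y) :* (x′ :* y′) := (x :* x′) :* (y :* y′)) refl x y (x ⁻¹) (y ⁻¹) ⟩
    (x * x ⁻¹) * (y * y ⁻¹)   ≈⟨ *-cong (x*x⁻¹≈1 x≉0) (x*x⁻¹≈1 y≉0) ⟩
    1# * 1#                   ≈⟨ *-identityˡ 1# ⟩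
    1#                        ∎))

  -‿⁻¹ : ∀ {x} → x ≉ 0# → (- x) ⁻¹ ≈ - x ⁻¹
  -‿⁻¹ {x} x≉0 = sym (x*y≈1⇒y≈x⁻¹ (trans (solve 2 (λ x y → (:- x) :* (:- y) := x :* y) refl x (x ⁻¹)) (x*x⁻¹≈1 x≉0)))

  a*x≈b⇒x≈b*a⁻¹ : ∀ {a x b} → a ≉ 0# → a * x ≈ b → x ≈ b * a ⁻¹
  a*x≈b⇒x≈b*a⁻¹ {a} {x} {b} a≉0 ax≈b = *-cancelˡ a≉0 (begin
    a * x             ≈⟨ ax≈b ⟩
    b                 ≈⟨ *-identityʳ b ⟨
    b * 1#            ≈⟨ *-congˡ (x*x⁻¹≈1 a≉0) ⟨
    b * (a * a ⁻¹)    ≈⟨ solve 3 (λ b a a′ → b :* (a :* a′) := a :* (b :* a′)) refl b a (a ⁻¹) ⟩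
    a * (b * a ⁻¹)    ∎)

  a*d≈c*b⇒a*b⁻¹≈c*d⁻¹ : ∀ {a b c d} → b ≉ 0# → d ≉ 0# → a * d ≈ c * b → a * b ⁻¹ ≈ c * d ⁻¹
  a*d≈c*b⇒a*b⁻¹≈c*d⁻¹ {a} {b} {c} {d} b≉0 d≉0 ad≈cb = a*x≈b⇒x≈b*a⁻¹ d≉0 (begin
    d * (a * b ⁻¹)    ≈⟨ solve 3 (λ d a b′ → d :* (a :* b′) := (a :* d) :* b′) refl d a (b ⁻¹) ⟩
    (a * d) * b ⁻¹    ≈⟨ *-congʳ ad≈cb ⟩
    (c * b) * b ⁻¹    ≈⟨ *-assoc c b (b ⁻¹) ⟩
    c * (b * b ⁻¹)    ≈⟨ *-congˡ (x*x⁻¹≈1 b≉0) ⟩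
    c * 1#            ≈⟨ *-identityʳ c ⟩
    c                 ∎)

  x*x≈y*y⇒x≈y⊎x≈-y : ∀ {x y} → x * x ≈ y * y → x ≈ y ⊎ x ≈ - y
  x*x≈y*y⇒x≈y⊎x≈-y {x} {y} xx≈yy with x*y≈0⇒x≈0⊎y≈0 {x - y} {x + y} (begin
      (x - y) * (x + y)   ≈⟨ solve 2 (λ x y → (x :- y) :* (x :+ y) := x :* x :- y :* y) refl x y ⟩
      x * x - y * y       ≈⟨ x≈y⇒x-y≈0 xx≈yy ⟩
      0#                  ∎)
  ... | inj₁ x-y≈0 = inj₁ (x-y≈0⇒x≈y x y x-y≈0)
  ... | inj₂ x+y≈0 = inj₂ (x-y≈0⇒x≈y x (- y) (trans (+-congˡ (-‿involutive y)) x+y≈0))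

  module _ (2≉0 : fromℕ 2 ≉ 0#) where

    x+x≈0⇒x≈0 : ∀ {x} → x + x ≈ 0# → x ≈ 0#
    x+x≈0⇒x≈0 {x} x+x≈0 with x*y≈0⇒x≈0⊎y≈0 (trans (solve 1 (λ x → κ 2 :* x := x :+ x) refl x) x+x≈0)
    ... | inj₁ 2≈0 = ⊥-elim (2≉0 2≈0)
    ... | inj₂ x≈0 = x≈0

    x≈-x⇒x≈0 : ∀ {x} → x ≈ - x → x ≈ 0#
    x≈-x⇒x≈0 {x} x≈-x = x+x≈0⇒x≈0 (trans (+-congˡ x≈-x) (-‿inverseʳ x))

module FiniteFieldCounting {c ℓ} (F : FiniteField c ℓ) where
  open FiniteField F
  open IntegerCoefficients commRing
  open FieldLemmas F
  open UniqueLists setoid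
  open import Algebra.Properties.Semiring.Exp semiring using (_^_; ^-homo-*)
  open import Data.List.Membership.Setoid setoid using (_∈_)
  open import Data.List.Membership.Setoid.Properties using (∈-filter⁺; ∈-filter⁻; ∈-resp-≈)
  open import Data.List.Relation.Unary.Unique.Setoid setoid using (Unique)
  open import Data.List.Relation.Unary.Unique.Setoid.Properties using (filter⁺; Unique[x∷xs]⇒x∉xs)
  open import Algebra.Properties.Group +-group using (∙-cancelˡ; ∙-cancelʳ)
  open import Relation.Binary.Properties.Setoid setoid using (≉-respˡ)
  open import Relation.Binary.Reasoning.Setoid setoid

  ∑ ∏ : List Carrier → Carrier
  ∑ = foldr _+_ 0#
  ∏ = foldr _*_ 1#

  ∑-↭ : ∀ {xs ys} → xs ↭ ys → ∑ xs ≈ ∑ ys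
  ∑-↭ = foldr-commMonoid +-isCommutativeMonoid

  ∏-↭ : ∀ {xs ys} → xs ↭ ys → ∏ xs ≈ ∏ ys
  ∏-↭ = foldr-commMonoid *-isCommutativeMonoid

  ∈-elems : ∀ x → x ∈ elems
  ∈-elems = complete

  ∑-map-+1 : ∀ xs → ∑ (map (_+ 1#) xs) ≈ ∑ xs + fromℕ (length xs)
  ∑-map-+1 []       = sym (+-identityʳ 0#)
  ∑-map-+1 (x ∷ xs) = begin
    (x + 1#) + ∑ (map (_+ 1#) xs)              ≈⟨ +-congˡ (∑-map-+1 xs) ⟩
    (x + 1#) + (∑ xs + fromℕ (length xs))      ≈⟨ solve 3 (λ x s n → (x :+ κ 1) :+ (s :+ n) := (x :+ s) :+ (κ 1 :+ n)) refl x (∑ xs) (fromℕ (length xs)) ⟩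
    (x + ∑ xs) + (1# + fromℕ (length xs))      ≈⟨ +-congˡ (fromℕ-suc (length xs)) ⟨
    (x + ∑ xs) + fromℕ (suc (length xs))       ∎

  -- Translation by 1 permutes the field, so summing over it adds |F| · 1 without changing the sum.
  characteristic : fromℕ (length elems) ≈ 0#
  characteristic = ∙-cancelˡ (∑ elems) (fromℕ (length elems)) 0# (begin
    ∑ elems + fromℕ (length elems)   ≈⟨ ∑-map-+1 elems ⟨
    ∑ (map (_+ 1#) elems)            ≈⟨ ∑-↭ (map-↭ +-congʳ +1-injective distinct (λ {x} _ → ∈-elems (x + 1#)) onto) ⟩
    ∑ elems                          ≈⟨ +-identityʳ _ ⟨
    ∑ elems + 0#                     ∎)
    where
    +1-injective : ∀ {x y} → x + 1# ≈ y + 1# → x ≈ y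
    +1-injective {x} {y} = ∙-cancelʳ 1# x y
    onto : ∀ {y} → y ∈ elems → ∃ λ x → x ∈ elems × y ≈ x + 1#
    onto {y} _ = y - 1# , ∈-elems (y - 1#) , solve 1 (λ y → y := (y :- κ 1) :+ κ 1) refl y

  nonzero? : ∀ x → Dec (x ≉ 0#)
  nonzero? x = ¬? (x ≟ 0#)

  ↭-0∷filter-nonzero : ∀ {xs} → Unique xs → 0# ∈ xs → xs ↭ 0# ∷ filter nonzero? xs
  ↭-0∷filter-nonzero {xs} xs! 0∈xs = Unique-⊆-⊇⇒↭ xs! 0∷nz! split join
    where
    ∈-nz⁻ : ∀ {x} → x ∈ filter nonzero? xs → x ∈ xs × x ≉ 0#
    ∈-nz⁻ = ∈-filter⁻ setoid nonzero? ≉-respˡ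
    0∷nz! : Unique (0# ∷ filter nonzero? xs)
    0∷nz! = All.tabulateₛ setoid (λ x∈ 0≈x → proj₂ (∈-nz⁻ x∈) (sym 0≈x)) ∷ filter⁺ setoid nonzero? xs!
    split : ∀ {x} → x ∈ xs → x ∈ 0# ∷ filter nonzero? xs
    split {x} x∈xs with x ≟ 0#
    ... | yes x≈0 = here x≈0
    ... | no x≉0  = there (∈-filter⁺ setoid nonzero? ≉-respˡ x∈xs x≉0)
    join : ∀ {x} → x ∈ 0# ∷ filter nonzero? xs → x ∈ xs
    join (here x≈0)  = ∈-resp-≈ setoid (sym x≈0) 0∈xs
    join (there x∈)  = proj₁ (∈-nz⁻ x∈)

  nonzeros : List Carrier
  nonzeros = filter nonzero? elems

  ∈-nonzeros⁺ : ∀ {x} → x ≉ 0# → x ∈ nonzeros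
  ∈-nonzeros⁺ {x} x≉0 = ∈-filter⁺ setoid nonzero? ≉-respˡ (∈-elems x) x≉0

  ∈-nonzeros⁻ : ∀ {x} → x ∈ nonzeros → x ≉ 0#
  ∈-nonzeros⁻ x∈ = proj₂ (∈-filter⁻ setoid nonzero? ≉-respˡ {xs = elems} x∈)

  nonzeros-unique : Unique nonzeros
  nonzeros-unique = filter⁺ setoid nonzero? distinct

  elems↭0∷nonzeros : elems ↭ 0# ∷ nonzeros
  elems↭0∷nonzeros = ↭-0∷filter-nonzero distinct (∈-elems 0#)

  |F|≡1+|F*| : length elems ≡ suc (length nonzeros)
  |F|≡1+|F*| = xs↭ys⇒|xs|≡|ys| elems↭0∷nonzeros

  ∏-map-* : ∀ a xs → ∏ (map (a *_) xs) ≈ a ^ length xs * ∏ xs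
  ∏-map-* a []       = sym (*-identityˡ 1#)
  ∏-map-* a (x ∷ xs) = begin
    (a * x) * ∏ (map (a *_) xs)           ≈⟨ *-congˡ (∏-map-* a xs) ⟩
    (a * x) * (a ^ length xs * ∏ xs)      ≈⟨ solve 4 (λ a x w r → (a :* x) :* (w :* r) := (a :* w) :* (x :* r)) refl a x (a ^ length xs) (∏ xs) ⟩
    (a * a ^ length xs) * (x * ∏ xs)      ∎

  ∏-nonzeros-≉0 : ∏ nonzeros ≉ 0#
  ∏-nonzeros-≉0 = go (All.tabulateₛ setoid ∈-nonzeros⁻)
    where
    go : ∀ {xs} → All.All (_≉ 0#) xs → ∏ xs ≉ 0#
    go All.[]           = 1≉0
    go (x≉0 All.∷ xs≉0) = *-≉0 x≉0 (go xs≉0)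

  -- Multiplication by a nonzero x permutes the nonzero elements.
  fermat* : ∀ {x} → x ≉ 0# → x ^ length nonzeros ≈ 1#
  fermat* {x} x≉0 = *-cancelˡ ∏-nonzeros-≉0 (begin
    ∏ nonzeros * x ^ length nonzeros   ≈⟨ *-comm _ _ ⟩
    x ^ length nonzeros * ∏ nonzeros   ≈⟨ ∏-map-* x nonzeros ⟨
    ∏ (map (x *_) nonzeros)            ≈⟨ ∏-↭ (map-↭ *-congˡ (*-cancelˡ x≉0) nonzeros-unique into onto) ⟩
    ∏ nonzeros                         ≈⟨ *-identityʳ _ ⟨
    ∏ nonzeros * 1#                    ∎)
    where
    into : ∀ {y} → y ∈ nonzeros → x * y ∈ nonzeros
    into y∈ = ∈-nonzeros⁺ (*-≉0 x≉0 (∈-nonzeros⁻ y∈))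
    onto : ∀ {y} → y ∈ nonzeros → ∃ λ z → z ∈ nonzeros × y ≈ x * z
    onto {y} y∈ = x ⁻¹ * y , ∈-nonzeros⁺ (*-≉0 (⁻¹-≉0 x≉0) (∈-nonzeros⁻ y∈)) , (begin
      y                  ≈⟨ *-identityˡ y ⟨
      1# * y             ≈⟨ *-congʳ (x*x⁻¹≈1 x≉0) ⟨
      (x * x ⁻¹) * y     ≈⟨ *-assoc x (x ⁻¹) y ⟩
      x * (x ⁻¹ * y)     ∎)

  fermat : ∀ x → x ^ length elems ≈ x
  fermat x with x ≟ 0#
  ... | yes x≈0 rewrite |F|≡1+|F*| = trans (*-congʳ x≈0) (trans (zeroˡ _) (sym x≈0))
  ... | no x≉0  rewrite |F|≡1+|F*| = trans (*-congˡ (fermat* x≉0)) (*-identityʳ x)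

  record PairedBy (σ : Carrier → Carrier) (a : Carrier) (xs : List Carrier) : Set (c ⊔ ℓ) where
    field
      unique     : Unique xs
      closed     : ∀ {y} → y ∈ xs → σ y ∈ xs
      fixed-free : ∀ {y} → y ∈ xs → σ y ≉ y
      involutive : ∀ {y} → y ∈ xs → σ (σ y) ≈ y
      pair-product : ∀ {y} → y ∈ xs → y * σ y ≈ a

  PairProduct : Carrier → List Carrier → Set ℓ
  PairProduct a xs = ∃ λ k → 2 ℕ.* k ≡ length xs × ∏ xs ≈ a ^ k

  module _ {σ : Carrier → Carrier} (σ-cong : ∀ {x y} → x ≈ y → σ x ≈ σ y) {a : Carrier} where

    PairedBy-remove-pair : ∀ {x xs′ rest} → PairedBy σ a (x ∷ xs′) → xs′ ↭ σ x ∷ rest → PairedBy σ a rest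
    PairedBy-remove-pair {x} {xs′} {rest} P xs′↭ = record
      { unique       = tail σx∷rest!
      ; closed       = rest-closed
      ; fixed-free   = fixed-free ∘ there ∘ in-xs′
      ; involutive   = involutive ∘ there ∘ in-xs′
      ; pair-product = pair-product ∘ there ∘ in-xs′
      }
      where
      open PairedBy P
      σx∷rest! : Unique (σ x ∷ rest)
      σx∷rest! = Unique-resp-↭ xs′↭ (tail unique)
      in-xs′ : ∀ {y} → y ∈ rest → y ∈ xs′
      in-xs′ y∈ = ∈-resp-↭ (↭-sym xs′↭) (there y∈)
      rest-closed : ∀ {y} → y ∈ rest → σ y ∈ rest
      rest-closed {y} y∈ = ∈-∷⁻ (∈-resp-↭ xs′↭ (∈-∷⁻ (closed (there (in-xs′ y∈))) σy≉x)) σy≉σx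
        where
        y≈σσy : y ≈ σ (σ y)
        y≈σσy = sym (involutive (there (in-xs′ y∈)))
        σy≉x : σ y ≉ x
        σy≉x σy≈x = Unique[x∷xs]⇒x∉xs setoid σx∷rest! (∈-resp-≈ setoid (trans y≈σσy (σ-cong σy≈x)) y∈)
        σy≉σx : σ y ≉ σ x
        σy≉σx σy≈σx = Unique[x∷xs]⇒x∉xs setoid unique
          (∈-resp-≈ setoid (trans y≈σσy (trans (σ-cong σy≈σx) (involutive (here refl)))) (in-xs′ y∈))

    -- Remove x and σ x, which contribute the factor a, and recurse on the remaining list.
    ∏-pairedBy : ∀ {xs} → PairedBy σ a xs → PairProduct a xs
    ∏-pairedBy {xs} = go xs (<-wellFounded (length xs))
      where
      go : ∀ xs → Acc ℕ._<_ (length xs) → PairedBy σ a xs → PairProduct a xs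
      go []        _        _ = 0 , ≡.refl , refl
      go (x ∷ xs′) (acc rs) P = remove-pair (∈⇒↭-∷ (∈-∷⁻ (closed (here refl)) (fixed-free (here refl))))
        where
        open PairedBy P
        remove-pair : (∃ λ rest → xs′ ↭ σ x ∷ rest) → PairProduct a (x ∷ xs′)
        remove-pair (rest , xs′↭) = combine (go rest (rs |rest|<|xs|) (PairedBy-remove-pair P xs′↭))
          where
          |xs′|≡1+|rest| : length xs′ ≡ suc (length rest)
          |xs′|≡1+|rest| = xs↭ys⇒|xs|≡|ys| xs′↭
          |rest|<|xs| : length rest ℕ.< length (x ∷ xs′)
          |rest|<|xs| rewrite |xs′|≡1+|rest| = ℕ.<-trans (ℕ.n<1+n _) (ℕ.n<1+n _)
          combine : PairProduct a rest → PairProduct a (x ∷ xs′)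
          combine (k , 2k≡|rest| , ∏rest≈aᵏ) = suc k , 2[1+k]≡|xs| , (begin
            x * ∏ xs′                ≈⟨ *-congˡ (∏-↭ xs′↭) ⟩
            x * (σ x * ∏ rest)       ≈⟨ *-assoc x (σ x) (∏ rest) ⟨
            (x * σ x) * ∏ rest       ≈⟨ *-cong (pair-product (here refl)) ∏rest≈aᵏ ⟩
            a * a ^ k                ∎)
            where
            2[1+k]≡|xs| : 2 ℕ.* suc k ≡ suc (length xs′)
            2[1+k]≡|xs| rewrite |xs′|≡1+|rest| | ≡.sym 2k≡|rest| = ≡.cong suc (ℕ.+-suc k (k ℕ.+ 0))

  module _ (2≉0 : fromℕ 2 ≉ 0#) where

    1≉-1 : 1# ≉ - 1#
    1≉-1 1≈-1 = 2≉0 (trans (+-congˡ 1≈-1) (-‿inverseʳ 1#))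

    private
      Not±1 : Carrier → Set ℓ
      Not±1 x = x ≉ 1# × x ≉ - 1#

      not±1? : ∀ x → Dec (Not±1 x)
      not±1? x = ¬? (x ≟ 1#) ×-dec ¬? (x ≟ (- 1#))

      Not±1-resp : ∀ {x y} → x ≈ y → Not±1 x → Not±1 y
      Not±1-resp x≈y (x≉1 , x≉-1) = (λ y≈1 → x≉1 (trans x≈y y≈1)) , (λ y≈-1 → x≉-1 (trans x≈y y≈-1))

      others : List Carrier
      others = filter not±1? nonzeros

      ∈-others⁻ : ∀ {y} → y ∈ others → y ≉ 0# × Not±1 y
      ∈-others⁻ y∈ with y∈nonzeros , not±1 ← ∈-filter⁻ setoid not±1? Not±1-resp {xs = nonzeros} y∈ =
        ∈-nonzeros⁻ y∈nonzeros , not±1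

      ∈-others⁺ : ∀ {y} → y ≉ 0# → Not±1 y → y ∈ others
      ∈-others⁺ y≉0 not±1 = ∈-filter⁺ setoid not±1? Not±1-resp (∈-nonzeros⁺ y≉0) not±1

      nonzeros↭±1∷others : nonzeros ↭ 1# ∷ - 1# ∷ others
      nonzeros↭±1∷others = Unique-⊆-⊇⇒↭ nonzeros-unique ±1∷others-unique (λ y∈ → split (∈-nonzeros⁻ y∈)) ⊇
        where
        ±1∷others-unique : Unique (1# ∷ - 1# ∷ others)
        ±1∷others-unique =
          (1≉-1 All.∷ All.tabulateₛ setoid (λ y∈ 1≈y → proj₁ (proj₂ (∈-others⁻ y∈)) (sym 1≈y)))
          ∷ All.tabulateₛ setoid (λ y∈ -1≈y → proj₂ (proj₂ (∈-others⁻ y∈)) (sym -1≈y))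
          ∷ filter⁺ setoid not±1? nonzeros-unique
        split : ∀ {y} → y ≉ 0# → y ∈ 1# ∷ - 1# ∷ others
        split {y} y≉0 with y ≟ 1# | y ≟ (- 1#)
        ... | yes y≈1 | _        = here y≈1
        ... | no _    | yes y≈-1 = there (here y≈-1)
        ... | no y≉1  | no y≉-1  = there (there (∈-others⁺ y≉0 (y≉1 , y≉-1)))
        ⊇ : ∀ {y} → y ∈ 1# ∷ - 1# ∷ others → y ∈ nonzeros
        ⊇ (here y≈1)          = ∈-nonzeros⁺ λ y≈0 → 1≉0 (trans (sym y≈1) y≈0)
        ⊇ (there (here y≈-1)) = ∈-nonzeros⁺ λ y≈0 → -‿≉0 1≉0 (trans (sym y≈-1) y≈0)
        ⊇ (there (there y∈))  = ∈-nonzeros⁺ (proj₁ (∈-others⁻ y∈))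

      x*x≈1⇒x≈±1 : ∀ {x} → x * x ≈ 1# → x ≈ 1# ⊎ x ≈ - 1#
      x*x≈1⇒x≈±1 xx≈1 = x*x≈y*y⇒x≈y⊎x≈-y (trans xx≈1 (sym (*-identityˡ 1#)))

      1⁻¹≈1 : 1# ⁻¹ ≈ 1#
      1⁻¹≈1 = sym (x*y≈1⇒y≈x⁻¹ (*-identityˡ 1#))

      -1⁻¹≈-1 : (- 1#) ⁻¹ ≈ - 1#
      -1⁻¹≈-1 = trans (-‿⁻¹ 1≉0) (-‿cong 1⁻¹≈1)

      1^k≈1 : ∀ k → 1# ^ k ≈ 1#
      1^k≈1 zero    = refl
      1^k≈1 (suc k) = trans (*-identityˡ _) (1^k≈1 k)

    -- Every element other than ±1 is paired with its distinct inverse.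
    wilson : ∏ nonzeros ≈ - 1#
    wilson = from-pairing (∏-pairedBy ⁻¹-cong inverse-pairing)
      where
      from-pairing : PairProduct 1# others → ∏ nonzeros ≈ - 1#
      from-pairing (k , _ , ∏others≈1ᵏ) = begin
        ∏ nonzeros                  ≈⟨ ∏-↭ nonzeros↭±1∷others ⟩
        1# * (- 1# * ∏ others)      ≈⟨ *-identityˡ _ ⟩
        - 1# * ∏ others             ≈⟨ *-congˡ (trans ∏others≈1ᵏ (1^k≈1 k)) ⟩
        - 1# * 1#                   ≈⟨ *-identityʳ _ ⟩
        - 1#                        ∎
      inverse-pairing : PairedBy _⁻¹ 1# others
      inverse-pairing = record
        { unique       = filter⁺ setoid not±1? nonzeros-unique
        ; closed       = λ y∈ → let y≉0 , y≉1 , y≉-1 = ∈-others⁻ y∈ in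
            ∈-others⁺ (⁻¹-≉0 y≉0)
              ( (λ y⁻¹≈1  → y≉1  (trans (sym (⁻¹-involutive y≉0)) (trans (⁻¹-cong y⁻¹≈1) 1⁻¹≈1)))
              , (λ y⁻¹≈-1 → y≉-1 (trans (sym (⁻¹-involutive y≉0)) (trans (⁻¹-cong y⁻¹≈-1) -1⁻¹≈-1))))
        ; fixed-free   = λ y∈ y⁻¹≈y → let y≉0 , y≉1 , y≉-1 = ∈-others⁻ y∈ in
            [ y≉1 , y≉-1 ] (x*x≈1⇒x≈±1 (trans (*-congˡ (sym y⁻¹≈y)) (x*x⁻¹≈1 y≉0)))
        ; involutive   = ⁻¹-involutive ∘ proj₁ ∘ ∈-others⁻
        ; pair-product = x*x⁻¹≈1 ∘ proj₁ ∘ ∈-others⁻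
        }

    private
      quotient-pairing : ∀ {x} → ¬ (∃ λ y → y * y ≈ x) → PairedBy (λ y → x * y ⁻¹) x nonzeros
      quotient-pairing {x} nonsquare = record
        { unique       = nonzeros-unique
        ; closed       = λ y∈ → ∈-nonzeros⁺ (*-≉0 x≉0 (⁻¹-≉0 (∈-nonzeros⁻ y∈)))
        ; fixed-free   = λ {y} y∈ xy⁻¹≈y → nonsquare (y , trans (*-congˡ (sym xy⁻¹≈y)) (y*xy⁻¹≈x (∈-nonzeros⁻ y∈)))
        ; involutive   = λ {y} y∈ → let y≉0 = ∈-nonzeros⁻ y∈ in begin
            x * (x * y ⁻¹) ⁻¹        ≈⟨ *-congˡ (⁻¹-distrib-* x≉0 (⁻¹-≉0 y≉0)) ⟩
            x * (x ⁻¹ * y ⁻¹ ⁻¹)     ≈⟨ *-congˡ (*-congˡ (⁻¹-involutive y≉0)) ⟩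
            x * (x ⁻¹ * y)           ≈⟨ *-assoc x (x ⁻¹) y ⟨
            (x * x ⁻¹) * y           ≈⟨ *-congʳ (x*x⁻¹≈1 x≉0) ⟩
            1# * y                   ≈⟨ *-identityˡ y ⟩
            y                        ∎
        ; pair-product = y*xy⁻¹≈x ∘ ∈-nonzeros⁻
        }
        where
        x≉0 : x ≉ 0#
        x≉0 x≈0 = nonsquare (0# , trans (zeroˡ 0#) (sym x≈0))
        y*xy⁻¹≈x : ∀ {y} → y ≉ 0# → y * (x * y ⁻¹) ≈ x
        y*xy⁻¹≈x {y} y≉0 = begin
          y * (x * y ⁻¹)    ≈⟨ solve 3 (λ y x y′ → y :* (x :* y′) := x :* (y :* y′)) refl y x (y ⁻¹) ⟩
          x * (y * y ⁻¹)    ≈⟨ *-congˡ (x*x⁻¹≈1 y≉0) ⟩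
          x * 1#            ≈⟨ *-identityʳ x ⟩
          x                 ∎

    -- Pairing y with x y⁻¹ gives ∏ F* = x^k, while Wilson gives ∏ F* = -1.
    euler : ∀ {x} → ¬ (∃ λ y → y * y ≈ x) → ∃ λ k → 2 ℕ.* k ≡ length nonzeros × x ^ k ≈ - 1#
    euler {x} nonsquare with k , 2k≡|F*| , ∏≈xᵏ ← ∏-pairedBy (*-congˡ ∘ ⁻¹-cong) (quotient-pairing nonsquare) =
      k , 2k≡|F*| , trans (sym ∏≈xᵏ) wilson

module QuadraticExtension {c ℓ} (F : FiniteField c ℓ) {p m : ℕ} (p-prime : Prime p) (p≢2 : ¬ p ≡ 2)
                          (|F|≡q² : length (FiniteField.elems F) ≡ (p ℕ.^ m) ℕ.^ 2) where
  open FiniteField F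
  open IntegerCoefficients commRing
  open FieldLemmas F
  open FiniteFieldCounting F
  open Plane F (p ℕ.^ m)
  open UniqueLists setoid
  open import Algebra.Properties.Semiring.Exp semiring using (_^_; ^-congˡ; ^-assocʳ; ^-homo-*)
  open import Algebra.Properties.CommutativeSemiring.Exp commutativeSemiring using (^-distrib-*)
  open import Algebra.Properties.Semiring.Mult.TCOptimised semiring using (×ᵤ≈×; ×1-homo-*)
  open import Algebra.Properties.Ring ring using (-‿involutive; -‿distribˡ-*; -‿distribʳ-*)
  open import Algebra.Properties.Group +-group using (∙-cancelˡ; ∙-cancelʳ; inverseʳ-unique)
    renaming (x∙y⁻¹≈ε⇒x≈y to x-y≈0⇒x≈y; x≈y⇒x∙y⁻¹≈ε to x≈y⇒x-y≈0)
  open import Data.List.Membership.Setoid setoid using (_∈_)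
  open import Data.List.Membership.Setoid.Properties
    using (∈-filter⁺; ∈-filter⁻; ∈-resp-≈; ∈-map⁻; ∈-cartesianProductWith⁺)
  open import Data.List.Relation.Unary.Unique.Setoid setoid using (Unique)
  open import Data.List.Relation.Unary.Unique.Setoid.Properties using (filter⁺; ++⁺)
  open import Relation.Binary.Properties.Setoid setoid using (≉-respˡ)
  open import Relation.Binary.Reasoning.Setoid setoid

  q : ℕ
  q = p ℕ.^ m

  pow≈^ : ∀ x n → pow x n ≈ x ^ n
  pow≈^ x zero    = refl
  pow≈^ x (suc n) = *-congˡ (pow≈^ x n)

  fromℕ-* : ∀ m n → fromℕ (m ℕ.* n) ≈ fromℕ m * fromℕ n
  fromℕ-* = ×1-homo-*

  characteristic-p : fromℕ p ≈ 0#
  characteristic-p = p^k≈0⇒p≈0 m (x*x≈0⇒x≈0 (begin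
    fromℕ q * fromℕ q              ≈⟨ fromℕ-* q q ⟨
    fromℕ (q ℕ.* q)                ≡⟨ ≡.cong fromℕ (≡.trans (≡.cong (q ℕ.*_) (≡.sym (ℕ.*-identityʳ q))) (≡.sym |F|≡q²)) ⟩
    fromℕ (length elems)           ≈⟨ characteristic ⟩
    0#                             ∎))
    where
    p^k≈0⇒p≈0 : ∀ k → fromℕ (p ℕ.^ k) ≈ 0# → fromℕ p ≈ 0#
    p^k≈0⇒p≈0 zero    1≈0   = ⊥-elim (1≉0 1≈0)
    p^k≈0⇒p≈0 (suc k) p^k+1≈0 with x*y≈0⇒x≈0⊎y≈0 (trans (sym (fromℕ-* p (p ℕ.^ k))) p^k+1≈0)
    ... | inj₁ p≈0   = p≈0
    ... | inj₂ p^k≈0 = p^k≈0⇒p≈0 k p^k≈0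

  -- p = 2h + 1, so 1 = p - h · 2 would vanish if 2 did.
  2≉0 : fromℕ 2 ≉ 0#
  2≉0 2≈0 with h , p≡1+2h ← odd-prime p-prime p≢2 = 1≉0 (begin
    1#                       ≈⟨ +-identityʳ 1# ⟨
    1# + 0#                  ≈⟨ +-congˡ (zeroʳ (fromℕ h)) ⟨
    1# + fromℕ h * 0#        ≈⟨ +-congˡ (*-congˡ 2≈0) ⟨
    1# + fromℕ h * fromℕ 2   ≈⟨ +-congˡ (fromℕ-* h 2) ⟨
    1# + fromℕ (h ℕ.* 2)     ≈⟨ fromℕ-suc (h ℕ.* 2) ⟨
    fromℕ (suc (h ℕ.* 2))    ≡⟨ ≡.cong (fromℕ ∘ suc) (ℕ.*-comm h 2) ⟩
    fromℕ (suc (2 ℕ.* h))    ≡⟨ ≡.cong fromℕ p≡1+2h ⟨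
    fromℕ p                  ≈⟨ characteristic-p ⟩
    0#                       ∎)

  ^-distrib-+-p^k : ∀ k x y → (x + y) ^ (p ℕ.^ k) ≈ x ^ (p ℕ.^ k) + y ^ (p ℕ.^ k)
  ^-distrib-+-p^k zero    x y = trans (*-identityʳ _) (sym (+-cong (*-identityʳ x) (*-identityʳ y)))
  ^-distrib-+-p^k (suc k) x y = begin
    (x + y) ^ (p ℕ.* p ℕ.^ k)                   ≈⟨ ^-assocʳ (x + y) p (p ℕ.^ k) ⟨
    ((x + y) ^ p) ^ (p ℕ.^ k)                   ≈⟨ ^-congˡ (p ℕ.^ k) (frobenius p-prime (trans (×ᵤ≈× p 1#) characteristic-p) x y) ⟩
    (x ^ p + y ^ p) ^ (p ℕ.^ k)                 ≈⟨ ^-distrib-+-p^k k (x ^ p) (y ^ p) ⟩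
    (x ^ p) ^ (p ℕ.^ k) + (y ^ p) ^ (p ℕ.^ k)   ≈⟨ +-cong (^-assocʳ x p (p ℕ.^ k)) (^-assocʳ y p (p ℕ.^ k)) ⟩
    x ^ (p ℕ.* p ℕ.^ k) + y ^ (p ℕ.* p ℕ.^ k)   ∎
    where
    open Frobenius commRing using (frobenius)

  conj≈^q : ∀ x → conj x ≈ x ^ q
  conj≈^q x = pow≈^ x q

  conj-cong : ∀ {x y} → x ≈ y → conj x ≈ conj y
  conj-cong {x} {y} x≈y = trans (conj≈^q x) (trans (^-congˡ q x≈y) (sym (conj≈^q y)))

  conj-+ : ∀ x y → conj (x + y) ≈ conj x + conj y
  conj-+ x y = trans (conj≈^q _) (trans (^-distrib-+-p^k m x y) (sym (+-cong (conj≈^q x) (conj≈^q y))))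

  conj-* : ∀ x y → conj (x * y) ≈ conj x * conj y
  conj-* x y = trans (conj≈^q _) (trans (^-distrib-* x y q) (sym (*-cong (conj≈^q x) (conj≈^q y))))

  conj-0 : conj 0# ≈ 0#
  conj-0 = ∙-cancelʳ (conj 0#) (conj 0#) 0# (begin
    conj 0# + conj 0#   ≈⟨ conj-+ 0# 0# ⟨
    conj (0# + 0#)      ≈⟨ conj-cong (+-identityʳ 0#) ⟩
    conj 0#             ≈⟨ +-identityˡ _ ⟨
    0# + conj 0#        ∎)

  conj-1 : conj 1# ≈ 1#
  conj-1 = trans (conj≈^q 1#) (1^k≈1 q)
    where
    1^k≈1 : ∀ k → 1# ^ k ≈ 1#
    1^k≈1 zero    = refl
    1^k≈1 (suc k) = trans (*-identityˡ _) (1^k≈1 k)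

  conj‿- : ∀ x → conj (- x) ≈ - conj x
  conj‿- x = ∙-cancelʳ (conj x) (conj (- x)) (- conj x) (begin
    conj (- x) + conj x   ≈⟨ conj-+ (- x) x ⟨
    conj (- x + x)        ≈⟨ conj-cong (-‿inverseˡ x) ⟩
    conj 0#               ≈⟨ conj-0 ⟩
    0#                    ≈⟨ -‿inverseˡ (conj x) ⟨
    - conj x + conj x     ∎)

  conj-- : ∀ x y → conj (x - y) ≈ conj x - conj y
  conj-- x y = trans (conj-+ x (- y)) (+-congˡ (conj‿- y))

  conj-involutive : ∀ x → conj (conj x) ≈ x
  conj-involutive x = begin
    conj (conj x)          ≈⟨ trans (conj≈^q (conj x)) (^-congˡ q (conj≈^q x)) ⟩
    (x ^ q) ^ q            ≈⟨ ^-assocʳ x q q ⟩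
    x ^ (q ℕ.* q)          ≡⟨ ≡.cong (x ^_) (≡.trans (≡.cong (q ℕ.*_) (≡.sym (ℕ.*-identityʳ q))) (≡.sym |F|≡q²)) ⟩
    x ^ length elems       ≈⟨ fermat x ⟩
    x                      ∎

  conj-injective : ∀ {x y} → conj x ≈ conj y → x ≈ y
  conj-injective {x} {y} x̄≈ȳ = trans (sym (conj-involutive x)) (trans (conj-cong x̄≈ȳ) (conj-involutive y))

  conj-≉0 : ∀ {x} → x ≉ 0# → conj x ≉ 0#
  conj-≉0 x≉0 x̄≈0 = x≉0 (conj-injective (trans x̄≈0 (sym conj-0)))

  conj-⁻¹ : ∀ {x} → x ≉ 0# → conj (x ⁻¹) ≈ (conj x) ⁻¹
  conj-⁻¹ {x} x≉0 = x*y≈1⇒y≈x⁻¹ (trans (sym (conj-* x (x ⁻¹))) (trans (conj-cong (x*x⁻¹≈1 x≉0)) conj-1))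

  conj-fromℕ : ∀ n → conj (fromℕ n) ≈ fromℕ n
  conj-fromℕ zero    = conj-0
  conj-fromℕ (suc n) = begin
    conj (fromℕ (suc n))     ≈⟨ conj-cong (fromℕ-suc n) ⟩
    conj (1# + fromℕ n)      ≈⟨ conj-+ 1# (fromℕ n) ⟩
    conj 1# + conj (fromℕ n) ≈⟨ +-cong conj-1 (conj-fromℕ n) ⟩
    1# + fromℕ n             ≈⟨ fromℕ-suc n ⟨
    fromℕ (suc n)            ∎

  InGFq-cong : ∀ {a b} → a ≈ b → InGFq a → InGFq b
  InGFq-cong a≈b ā≈a = trans (conj-cong (sym a≈b)) (trans ā≈a a≈b)

  InGFq-+ : ∀ {a b} → InGFq a → InGFq b → InGFq (a + b)
  InGFq-+ ā≈a b̄≈b = trans (conj-+ _ _) (+-cong ā≈a b̄≈b)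

  InGFq-* : ∀ {a b} → InGFq a → InGFq b → InGFq (a * b)
  InGFq-* ā≈a b̄≈b = trans (conj-* _ _) (*-cong ā≈a b̄≈b)

  InGFq‿- : ∀ {a} → InGFq a → InGFq (- a)
  InGFq‿- ā≈a = trans (conj‿- _) (-‿cong ā≈a)

  InGFq-- : ∀ {a b} → InGFq a → InGFq b → InGFq (a - b)
  InGFq-- ā≈a b̄≈b = InGFq-+ ā≈a (InGFq‿- b̄≈b)

  InGFq-⁻¹ : ∀ {a} → a ≉ 0# → InGFq a → InGFq (a ⁻¹)
  InGFq-⁻¹ a≉0 ā≈a = trans (conj-⁻¹ a≉0) (⁻¹-cong ā≈a)

  InGFq-fromℕ : ∀ n → InGFq (fromℕ n)
  InGFq-fromℕ = conj-fromℕ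

  InGFq-trace : ∀ x → InGFq (x + conj x)
  InGFq-trace x = trans (conj-+ _ _) (trans (+-congˡ (conj-involutive x)) (+-comm _ _))

  InGFq-norm : ∀ x → InGFq (x * conj x)
  InGFq-norm x = trans (conj-* _ _) (trans (*-congˡ (conj-involutive x)) (*-comm _ _))

  4≉0 : fromℕ 4 ≉ 0#
  4≉0 4≈0 = *-≉0 2≉0 2≉0 (trans (sym (fromℕ-* 2 2)) 4≈0)

  B¹-resp : ∀ {c r z z′} → z ≈ z′ → B¹ c r (just z) → B¹ c r (just z′)
  B¹-resp z≈z′ on = trans (*-cong (+-congʳ (sym z≈z′)) (+-congʳ (conj-cong (sym z≈z′)))) on

  module Imaginary (ε : Carrier) (ε≉0 : ε ≉ 0#) (ε̄≈-ε : conj ε ≈ - ε) where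

    imaginary⇒w/ε∈GFq : ∀ {w} → conj w ≈ - w → InGFq (w * ε ⁻¹)
    imaginary⇒w/ε∈GFq {w} w̄≈-w = begin
      conj (w * ε ⁻¹)         ≈⟨ conj-* w (ε ⁻¹) ⟩
      conj w * conj (ε ⁻¹)    ≈⟨ *-cong w̄≈-w (trans (conj-⁻¹ ε≉0) (⁻¹-cong ε̄≈-ε)) ⟩
      (- w) * (- ε) ⁻¹        ≈⟨ a*d≈c*b⇒a*b⁻¹≈c*d⁻¹ (-‿≉0 ε≉0) ε≉0 (solve 2 (λ w e → (:- w) :* e := w :* (:- e)) refl w ε) ⟩
      w * ε ⁻¹                ∎

    module Line (γ : Carrier) (γ≉0 : γ ≉ 0#) where

      N : Carrier
      N = γ * conj γ

      N≉0 : N ≉ 0#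
      N≉0 = *-≉0 γ≉0 (conj-≉0 γ≉0)

      N∈GFq : InGFq N
      N∈GFq = InGFq-norm γ

      γε≉0 : γ * ε ≉ 0#
      γε≉0 = *-≉0 γ≉0 ε≉0

      conj-γεs : ∀ {s} → InGFq s → conj (γ * ε * s) ≈ conj γ * (- ε) * s
      conj-γεs {s} s̄≈s = trans (conj-* (γ * ε) s) (*-cong (trans (conj-* γ ε) (*-congˡ ε̄≈-ε)) s̄≈s)

      γεs∈line : ∀ {s} → InGFq s → B² γ 0# (just (γ * ε * s))
      γεs∈line {s} s̄≈s = trans (+-congˡ (*-congˡ (conj-γεs s̄≈s)))
        (solve 4 (λ g g′ e s → g′ :* (g :* e :* s) :+ g :* (g′ :* (:- e) :* s) := κ 0) refl γ (conj γ) ε s)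

      line⇒γεs : ∀ {z} → B² γ 0# (just z) → ∃ λ s → InGFq s × z ≈ γ * ε * s
      line⇒γεs {z} on = s , s∈GFq , z≈γεs
        where
        s : Carrier
        s = z * (γ * ε) ⁻¹
        z≈γεs : z ≈ γ * ε * s
        z≈γεs = sym (begin
          γ * ε * (z * (γ * ε) ⁻¹)       ≈⟨ solve 3 (λ a z a′ → a :* (z :* a′) := z :* (a :* a′)) refl (γ * ε) z ((γ * ε) ⁻¹) ⟩
          z * ((γ * ε) * (γ * ε) ⁻¹)     ≈⟨ *-congˡ (x*x⁻¹≈1 γε≉0) ⟩
          z * 1#                         ≈⟨ *-identityʳ z ⟩
          z                              ∎)
        z̄γε≈zγ̄[-ε] : conj z * (γ * ε) ≈ z * (conj γ * (- ε))
        z̄γε≈zγ̄[-ε] = x-y≈0⇒x≈y _ _ (begin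
          conj z * (γ * ε) - z * (conj γ * (- ε))
            ≈⟨ solve 5 (λ z′ g e z g′ → z′ :* (g :* e) :- z :* (g′ :* (:- e)) := e :* (g′ :* z :+ g :* z′)) refl (conj z) γ ε z (conj γ) ⟩
          ε * (conj γ * z + γ * conj z)  ≈⟨ *-congˡ on ⟩
          ε * 0#                         ≈⟨ zeroʳ ε ⟩
          0#                             ∎)
        s∈GFq : InGFq s
        s∈GFq = begin
          conj (z * (γ * ε) ⁻¹)                 ≈⟨ conj-* z _ ⟩
          conj z * conj ((γ * ε) ⁻¹)            ≈⟨ *-congˡ (trans (conj-⁻¹ γε≉0) (⁻¹-cong (trans (conj-* γ ε) (*-congˡ ε̄≈-ε)))) ⟩
          conj z * (conj γ * (- ε)) ⁻¹          ≈⟨ a*d≈c*b⇒a*b⁻¹≈c*d⁻¹ (*-≉0 (conj-≉0 γ≉0) (-‿≉0 ε≉0)) γε≉0 z̄γε≈zγ̄[-ε] ⟩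
          z * (γ * ε) ⁻¹                        ∎

      -- A second line B²(γ′, r′) always contains ∞, so tangency forbids any finite common point;
      -- but unless γ̄′ γ - γ′ γ̄ vanishes, the point γ ε s with s = r′ / (ε (γ̄′ γ - γ′ γ̄)) is one.
      tangent-B²⇒parallel : ∀ {γ′ r′} → InGFq r′ → Tangent (B² γ′ r′) (B² γ 0#) → conj γ′ * γ - γ′ * conj γ ≈ 0#
      tangent-B²⇒parallel {γ′} {r′} r′∈GFq (_ , P , _ , _ , only) = cases (d ≟ 0#)
        where
        e d : Carrier
        e = conj γ′ * γ - γ′ * conj γ
        d = ε * e
        no-finite-common-point : ∀ {z} P → (∀ Q → B² γ′ r′ Q → B² γ 0# Q → Q ≈P P) →
                                 B² γ′ r′ (just z) → B² γ 0# (just z) → ⊥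
        no-finite-common-point nothing  only on′ on = lower (only (just _) on′ on)
        no-finite-common-point (just _) only _   _  = lower (only nothing tt tt)
        cases : Dec (d ≈ 0#) → e ≈ 0#
        cases (yes d≈0) = *-cancelˡ ε≉0 (trans d≈0 (sym (zeroʳ ε)))
        cases (no d≉0)  = ⊥-elim (no-finite-common-point P only on′ (γεs∈line s∈GFq))
          where
          d∈GFq : InGFq d
          d∈GFq = begin
            conj (ε * e)                                   ≈⟨ conj-* ε e ⟩
            conj ε * conj (conj γ′ * γ - γ′ * conj γ)      ≈⟨ *-cong ε̄≈-ε (conj-- _ _) ⟩
            (- ε) * (conj (conj γ′ * γ) - conj (γ′ * conj γ))
              ≈⟨ *-congˡ (+-cong (trans (conj-* _ _) (*-congʳ (conj-involutive γ′))) (-‿cong (trans (conj-* _ _) (*-congˡ (conj-involutive γ))))) ⟩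
            (- ε) * (γ′ * conj γ - conj γ′ * γ)            ≈⟨ solve 5 (λ e a a′ g g′ → (:- e) :* (a :* g′ :- a′ :* g) := e :* (a′ :* g :- a :* g′)) refl ε γ′ (conj γ′) γ (conj γ) ⟩
            d                                              ∎
          s : Carrier
          s = r′ * d ⁻¹
          s∈GFq : InGFq s
          s∈GFq = InGFq-* r′∈GFq (InGFq-⁻¹ d≉0 d∈GFq)
          on′ : B² γ′ r′ (just (γ * ε * s))
          on′ = begin
            conj γ′ * (γ * ε * s) + γ′ * conj (γ * ε * s)            ≈⟨ +-congˡ (*-congˡ (conj-γεs s∈GFq)) ⟩
            conj γ′ * (γ * ε * s) + γ′ * (conj γ * (- ε) * s)        ≈⟨ solve 6 (λ a′ a g g′ e s → a′ :* (g :* e :* s) :+ a :* (g′ :* (:- e) :* s) := (e :* (a′ :* g :- a :* g′)) :* s) refl (conj γ′) γ′ γ (conj γ) ε s ⟩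
            d * (r′ * d ⁻¹)                                          ≈⟨ solve 3 (λ d r d′ → d :* (r :* d′) := r :* (d :* d′)) refl d r′ (d ⁻¹) ⟩
            r′ * (d * d ⁻¹)                                          ≈⟨ *-congˡ (x*x⁻¹≈1 d≉0) ⟩
            r′ * 1#                                                  ≈⟨ *-identityʳ r′ ⟩
            r′                                                       ∎

      -- On the line, B¹(c, r) becomes the quadratic X(s)² = Δ in s ∈ GF(q).
      module Meeting (c r : Carrier) (r∈GFq : InGFq r) where

        t w Δ : Carrier
        t = γ * conj c + conj γ * c
        w = γ * conj c - conj γ * c
        Δ = t * t - fromℕ 4 * (N * r)

        X : Carrier → Carrier
        X s = fromℕ 2 * N * ε * s + w

        TangencyCondition : Set ℓ
        TangencyCondition = t * t ≈ fromℕ 4 * (N * r)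

        t∈GFq : InGFq t
        t∈GFq = begin
          conj (γ * conj c + conj γ * c)              ≈⟨ conj-+ _ _ ⟩
          conj (γ * conj c) + conj (conj γ * c)       ≈⟨ +-cong (conj-* γ (conj c)) (conj-* (conj γ) c) ⟩
          conj γ * conj (conj c) + conj (conj γ) * conj c
                                                      ≈⟨ +-cong (*-congˡ (conj-involutive c)) (*-congʳ (conj-involutive γ)) ⟩
          conj γ * c + γ * conj c                     ≈⟨ +-comm _ _ ⟩
          t                                           ∎

        w̄≈-w : conj w ≈ - w
        w̄≈-w = begin
          conj (γ * conj c - conj γ * c)                  ≈⟨ conj-- _ _ ⟩
          conj (γ * conj c) - conj (conj γ * c)           ≈⟨ +-cong (conj-* γ (conj c)) (-‿cong (conj-* (conj γ) c)) ⟩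
          conj γ * conj (conj c) - conj (conj γ) * conj c ≈⟨ +-cong (*-congˡ (conj-involutive c)) (-‿cong (*-congʳ (conj-involutive γ))) ⟩
          conj γ * c - γ * conj c                         ≈⟨ solve 4 (λ g′ c g c′ → g′ :* c :- g :* c′ := :- (g :* c′ :- g′ :* c)) refl (conj γ) c γ (conj c) ⟩
          - w                                             ∎

        ρ : Carrier → Carrier
        ρ s = (γ * ε * s - c) * (conj γ * (- ε) * s - conj c)

        circle-quadratic : ∀ s → fromℕ 4 * N * (r - ρ s) ≈ X s * X s - Δ
        circle-quadratic s = solve 7 (λ g g′ c c′ e s r →
            κ 4 :* (g :* g′) :* (r :- (g :* e :* s :- c) :* (g′ :* (:- e) :* s :- c′))
          := (κ 2 :* (g :* g′) :* e :* s :+ (g :* c′ :- g′ :* c)) :* (κ 2 :* (g :* g′) :* e :* s :+ (g :* c′ :- g′ :* c))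
             :- ((g :* c′ :+ g′ :* c) :* (g :* c′ :+ g′ :* c) :- κ 4 :* ((g :* g′) :* r)))
          refl γ (conj γ) c (conj c) ε s r

        on-circle⇒ρ≈r : ∀ {s} → InGFq s → B¹ c r (just (γ * ε * s)) → ρ s ≈ r
        on-circle⇒ρ≈r s∈GFq on = trans (*-congˡ (+-congʳ (sym (conj-γεs s∈GFq)))) on

        ρ≈r⇒on-circle : ∀ {s} → InGFq s → ρ s ≈ r → B¹ c r (just (γ * ε * s))
        ρ≈r⇒on-circle s∈GFq ρ≈r = trans (*-congˡ (+-congʳ (conj-γεs s∈GFq))) ρ≈r

        on-circle⇒X²≈Δ : ∀ {s} → InGFq s → B¹ c r (just (γ * ε * s)) → X s * X s ≈ Δ
        on-circle⇒X²≈Δ {s} s∈GFq on = x-y≈0⇒x≈y (X s * X s) Δ (begin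
          X s * X s - Δ              ≈⟨ circle-quadratic s ⟨
          fromℕ 4 * N * (r - ρ s)    ≈⟨ *-congˡ (x≈y⇒x-y≈0 (sym (on-circle⇒ρ≈r s∈GFq on))) ⟩
          fromℕ 4 * N * 0#           ≈⟨ zeroʳ _ ⟩
          0#                         ∎)

        X²≈Δ⇒on-circle : ∀ {s} → InGFq s → X s * X s ≈ Δ → B¹ c r (just (γ * ε * s))
        X²≈Δ⇒on-circle {s} s∈GFq X²≈Δ =
          [ (λ 4N≈0 → ⊥-elim (*-≉0 4≉0 N≉0 4N≈0))
          , (λ r-ρ≈0 → ρ≈r⇒on-circle s∈GFq (sym (x-y≈0⇒x≈y r (ρ s) r-ρ≈0)))
          ] (x*y≈0⇒x≈0⊎y≈0 (trans (circle-quadratic s) (x≈y⇒x-y≈0 X²≈Δ)))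

        2N≉0 : fromℕ 2 * N ≉ 0#
        2N≉0 = *-≉0 2≉0 N≉0

        s₀ : Carrier
        s₀ = - (w * ε ⁻¹) * (fromℕ 2 * N) ⁻¹

        s₀∈GFq : InGFq s₀
        s₀∈GFq = InGFq-* (InGFq‿- (imaginary⇒w/ε∈GFq w̄≈-w)) (InGFq-⁻¹ 2N≉0 (InGFq-* (InGFq-fromℕ 2) N∈GFq))

        X-s₀≈0 : X s₀ ≈ 0#
        X-s₀≈0 = begin
          fromℕ 2 * N * ε * (- (w * ε ⁻¹) * (fromℕ 2 * N) ⁻¹) + w
            ≈⟨ solve 5 (λ n e w e′ n′ → κ 2 :* n :* e :* (:- (w :* e′) :* n′) :+ w := w :- w :* ((e :* e′) :* ((κ 2 :* n) :* n′))) refl N ε w (ε ⁻¹) ((fromℕ 2 * N) ⁻¹) ⟩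
          w - w * ((ε * ε ⁻¹) * (fromℕ 2 * N * (fromℕ 2 * N) ⁻¹))
            ≈⟨ +-congˡ (-‿cong (*-congˡ (*-cong (x*x⁻¹≈1 ε≉0) (x*x⁻¹≈1 2N≉0)))) ⟩
          w - w * (1# * 1#)
            ≈⟨ solve 1 (λ w → w :- w :* (κ 1 :* κ 1) := κ 0) refl w ⟩
          0#  ∎

        w≈-2Nεs₀ : w ≈ - (fromℕ 2 * N * ε * s₀)
        w≈-2Nεs₀ = inverseʳ-unique _ w X-s₀≈0

        X-cong : ∀ {s s′} → s ≈ s′ → X s ≈ X s′
        X-cong s≈s′ = +-congʳ (*-congˡ s≈s′)

        module _ (tc : TangencyCondition) where

          touching-point : Carrier
          touching-point = γ * ε * s₀

          touching-point∈circle : B¹ c r (just touching-point)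
          touching-point∈circle = X²≈Δ⇒on-circle s₀∈GFq (begin
            X s₀ * X s₀     ≈⟨ *-cong X-s₀≈0 X-s₀≈0 ⟩
            0# * 0#         ≈⟨ zeroˡ 0# ⟩
            0#              ≈⟨ x≈y⇒x-y≈0 tc ⟨
            Δ               ∎)

          touching-point-unique : ∀ {z} → B¹ c r (just z) → B² γ 0# (just z) → z ≈ touching-point
          touching-point-unique {z} on-circle on-line = at-root (line⇒γεs on-line)
            where
            at-root : (∃ λ s → InGFq s × z ≈ γ * ε * s) → z ≈ touching-point
            at-root (s , s∈GFq , z≈γεs) =
              trans z≈γεs (*-congˡ (*-cancelˡ (*-≉0 2N≉0 ε≉0) (∙-cancelʳ w _ _ (trans Xs≈0 (sym X-s₀≈0)))))
              where
              Xs≈0 : X s ≈ 0#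
              Xs≈0 = x*x≈0⇒x≈0 (trans (on-circle⇒X²≈Δ s∈GFq (B¹-resp z≈γεs on-circle)) (x≈y⇒x-y≈0 tc))

          tangent : Tangent (B¹ c r) (B² γ 0#)
          tangent = B¹≠B² , just touching-point , touching-point∈circle , γεs∈line s₀∈GFq , only
            where
            B¹≠B² : ¬ SameSet (B¹ c r) (B² γ 0#)
            B¹≠B² same = lower (proj₂ (same nothing) tt)
            only : ∀ Q → B¹ c r Q → B² γ 0# Q → Q ≈P just touching-point
            only (just z) on-circle on-line = touching-point-unique on-circle on-line

        -- The reflection s ↦ -s - w/(εN) sends X(s) to -X(s), hence preserves intersection points;
        -- a single intersection point must therefore be a root of X.
        tangent⇒tangencyCondition : Tangent (B¹ c r) (B² γ 0#) → TangencyCondition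
        tangent⇒tangencyCondition (_ , just z , on-circle , on-line , only) = at-root (line⇒γεs on-line)
          where
          at-root : (∃ λ s → InGFq s × z ≈ γ * ε * s) → TangencyCondition
          at-root (s , s∈GFq , z≈γεs) = x-y≈0⇒x≈y (t * t) (fromℕ 4 * (N * r)) Δ≈0
            where
            X²≈Δ : X s * X s ≈ Δ
            X²≈Δ = on-circle⇒X²≈Δ s∈GFq (B¹-resp z≈γεs on-circle)
            s′ : Carrier
            s′ = - s - (w * ε ⁻¹) * N ⁻¹
            s′∈GFq : InGFq s′
            s′∈GFq = InGFq-- (InGFq‿- s∈GFq) (InGFq-* (imaginary⇒w/ε∈GFq w̄≈-w) (InGFq-⁻¹ N≉0 N∈GFq))
            X-s′≈-X-s : X s′ ≈ - X s
            X-s′≈-X-s = begin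
              fromℕ 2 * N * ε * (- s - (w * ε ⁻¹) * N ⁻¹) + w
                ≈⟨ solve 6 (λ n e s w e′ n′ → κ 2 :* n :* e :* (:- s :- (w :* e′) :* n′) :+ w
                                            := (:- (κ 2 :* n :* e :* s) :- κ 2 :* w :* ((e :* e′) :* (n :* n′))) :+ w)
                     refl N ε s w (ε ⁻¹) (N ⁻¹) ⟩
              (- (fromℕ 2 * N * ε * s) - fromℕ 2 * w * ((ε * ε ⁻¹) * (N * N ⁻¹))) + w
                ≈⟨ +-congʳ (+-congˡ (-‿cong (*-congˡ (*-cong (x*x⁻¹≈1 ε≉0) (x*x⁻¹≈1 N≉0))))) ⟩
              (- (fromℕ 2 * N * ε * s) - fromℕ 2 * w * (1# * 1#)) + w
                ≈⟨ solve 4 (λ n e s w → (:- (κ 2 :* n :* e :* s) :- κ 2 :* w :* (κ 1 :* κ 1)) :+ w := :- (κ 2 :* n :* e :* s :+ w)) refl N ε s w ⟩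
              - X s ∎
            γεs′∈circle : B¹ c r (just (γ * ε * s′))
            γεs′∈circle = X²≈Δ⇒on-circle s′∈GFq (begin
              X s′ * X s′       ≈⟨ *-cong X-s′≈-X-s X-s′≈-X-s ⟩
              - X s * - X s     ≈⟨ solve 1 (λ x → (:- x) :* (:- x) := x :* x) refl (X s) ⟩
              X s * X s         ≈⟨ X²≈Δ ⟩
              Δ                 ∎)
            s′≈s : s′ ≈ s
            s′≈s = *-cancelˡ γε≉0 (trans (only (just (γ * ε * s′)) γεs′∈circle (γεs∈line s′∈GFq)) z≈γεs)
            Xs≈0 : X s ≈ 0#
            Xs≈0 = x≈-x⇒x≈0 2≉0 (trans (sym (X-cong s′≈s)) X-s′≈-X-s)
            Δ≈0 : Δ ≈ 0#
            Δ≈0 = trans (sym X²≈Δ) (trans (*-congˡ Xs≈0) (zeroʳ _))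

      -- A circle tangent to the line determines its touching point, hence w.
      w-determined : ∀ {c r c′ r′} (r∈GFq : InGFq r) (r′∈GFq : InGFq r′) →
                     Meeting.TangencyCondition c r r∈GFq → Meeting.TangencyCondition c′ r′ r′∈GFq →
                     SameSet (B¹ c r) (B¹ c′ r′) → Meeting.w c r r∈GFq ≈ Meeting.w c′ r′ r′∈GFq
      w-determined {c} {r} {c′} {r′} r∈GFq r′∈GFq tc tc′ same = begin
        M.w                                   ≈⟨ M.w≈-2Nεs₀ ⟩
        - (fromℕ 2 * N * ε * M.s₀)            ≈⟨ -‿cong (*-congˡ s₀≈s₀′) ⟩
        - (fromℕ 2 * N * ε * M′.s₀)           ≈⟨ M′.w≈-2Nεs₀ ⟨
        M′.w                                  ∎
        where
        module M  = Meeting c r r∈GFq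
        module M′ = Meeting c′ r′ r′∈GFq
        s₀≈s₀′ : M.s₀ ≈ M′.s₀
        s₀≈s₀′ = *-cancelˡ γε≉0 (M′.touching-point-unique tc′
          (proj₁ (same (just (M.touching-point tc))) (M.touching-point∈circle tc)) (γεs∈line M.s₀∈GFq))

    InGFq? : ∀ x → Dec (InGFq x)
    InGFq? x = pow x q ≟ x

    GFq : List Carrier
    GFq = filter InGFq? elems

    ∈-GFq⁺ : ∀ {x} → InGFq x → x ∈ GFq
    ∈-GFq⁺ {x} = ∈-filter⁺ setoid InGFq? InGFq-cong (∈-elems x)

    ∈-GFq⁻ : ∀ {x} → x ∈ GFq → InGFq x
    ∈-GFq⁻ x∈ = proj₂ (∈-filter⁻ setoid InGFq? InGFq-cong {xs = elems} x∈)

    GFq-unique : Unique GFq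
    GFq-unique = filter⁺ setoid InGFq? distinct

    a+bε : Carrier → Carrier → Carrier
    a+bε a b = a + b * ε

    private
      conj-a+bε : ∀ {a b} → InGFq a → InGFq b → conj (a+bε a b) ≈ a - b * ε
      conj-a+bε {a} {b} ā≈a b̄≈b = begin
        conj (a + b * ε)         ≈⟨ conj-+ a (b * ε) ⟩
        conj a + conj (b * ε)    ≈⟨ +-cong ā≈a (trans (conj-* b ε) (*-cong b̄≈b ε̄≈-ε)) ⟩
        a + b * (- ε)            ≈⟨ +-congˡ (-‿distribʳ-* b ε) ⟨
        a - b * ε                ∎

    -- Conjugating a + bε gives a - bε, so the two coordinates are recovered as half-sum and half-difference.
    a+bε-injective : ∀ {a a′ b b′} → InGFq a → InGFq a′ → InGFq b → InGFq b′ →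
                     a+bε a b ≈ a+bε a′ b′ → a ≈ a′ × b ≈ b′
    a+bε-injective {a} {a′} {b} {b′} a∈ a′∈ b∈ b′∈ eq = a≈a′ , b≈b′
      where
      eq̄ : a - b * ε ≈ a′ - b′ * ε
      eq̄ = trans (sym (conj-a+bε a∈ b∈)) (trans (conj-cong eq) (conj-a+bε a′∈ b′∈))
      a≈a′ : a ≈ a′
      a≈a′ = x-y≈0⇒x≈y _ _ (x+x≈0⇒x≈0 2≉0 (begin
        (a - a′) + (a - a′)
          ≈⟨ solve 5 (λ a a′ b b′ e → (a :- a′) :+ (a :- a′) := ((a :+ b :* e) :- (a′ :+ b′ :* e)) :+ ((a :- b :* e) :- (a′ :- b′ :* e))) refl a a′ b b′ ε ⟩
        (a+bε a b - a+bε a′ b′) + ((a - b * ε) - (a′ - b′ * ε))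
          ≈⟨ +-cong (x≈y⇒x-y≈0 eq) (x≈y⇒x-y≈0 eq̄) ⟩
        0# + 0#  ≈⟨ +-identityˡ 0# ⟩
        0#       ∎))
      b≈b′ : b ≈ b′
      b≈b′ = *-cancelˡ ε≉0 (trans (*-comm ε b) (trans (∙-cancelˡ a (b * ε) (b′ * ε) (trans eq (+-congʳ (sym a≈a′)))) (*-comm b′ ε)))

    decompose : ∀ z → ∃₂ λ a b → InGFq a × InGFq b × z ≈ a+bε a b
    decompose z = a , b , a∈GFq , b∈GFq , z≈a+bε
      where
      a b : Carrier
      a = (z + conj z) * fromℕ 2 ⁻¹
      b = (z - conj z) * ε ⁻¹ * fromℕ 2 ⁻¹
      a∈GFq : InGFq a
      a∈GFq = InGFq-* (InGFq-trace z) (InGFq-⁻¹ 2≉0 (InGFq-fromℕ 2))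
      b∈GFq : InGFq b
      b∈GFq = InGFq-* (imaginary⇒w/ε∈GFq (begin
        conj (z - conj z)              ≈⟨ conj-- z (conj z) ⟩
        conj z - conj (conj z)         ≈⟨ +-congˡ (-‿cong (conj-involutive z)) ⟩
        conj z - z                     ≈⟨ solve 2 (λ z′ z → z′ :- z := :- (z :- z′)) refl (conj z) z ⟩
        - (z - conj z)                 ∎)) (InGFq-⁻¹ 2≉0 (InGFq-fromℕ 2))
      z≈a+bε : z ≈ a+bε a b
      z≈a+bε = sym (begin
        (z + conj z) * fromℕ 2 ⁻¹ + (z - conj z) * ε ⁻¹ * fromℕ 2 ⁻¹ * ε
          ≈⟨ solve 5 (λ z z′ h e′ e → (z :+ z′) :* h :+ (z :- z′) :* e′ :* h :* e := z :* (κ 2 :* h) :+ (z :- z′) :* h :* (e :* e′ :- κ 1)) refl z (conj z) (fromℕ 2 ⁻¹) (ε ⁻¹) ε ⟩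
        z * (fromℕ 2 * fromℕ 2 ⁻¹) + (z - conj z) * fromℕ 2 ⁻¹ * (ε * ε ⁻¹ - 1#)
          ≈⟨ +-cong (*-congˡ (x*x⁻¹≈1 2≉0)) (*-congˡ (x≈y⇒x-y≈0 (x*x⁻¹≈1 ε≉0))) ⟩
        z * 1# + (z - conj z) * fromℕ 2 ⁻¹ * 0#
          ≈⟨ solve 3 (λ z z′ h → z :* κ 1 :+ (z :- z′) :* h :* κ 0 := z) refl z (conj z) (fromℕ 2 ⁻¹) ⟩
        z ∎)

    products↭elems : cartesianProductWith a+bε GFq GFq ↭ elems
    products↭elems = Unique-⊆-⊇⇒↭ products-unique distinct (λ {z} _ → ∈-elems z) onto
      where
      products-unique : Unique (cartesianProductWith a+bε GFq GFq)
      products-unique = Unique-cartesianProductWith a+bε GFq-unique GFq-unique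
        λ a∈ a′∈ b∈ b′∈ → a+bε-injective (∈-GFq⁻ a∈) (∈-GFq⁻ a′∈) (∈-GFq⁻ b∈) (∈-GFq⁻ b′∈)
      onto : ∀ {z} → z ∈ elems → z ∈ cartesianProductWith a+bε GFq GFq
      onto {z} _ = let a , b , a∈GFq , b∈GFq , z≈a+bε = decompose z in
        ∈-resp-≈ setoid (sym z≈a+bε)
          (∈-cartesianProductWith⁺ setoid setoid setoid (λ a≈a′ b≈b′ → +-cong a≈a′ (*-congʳ b≈b′))
                                   (∈-GFq⁺ a∈GFq) (∈-GFq⁺ b∈GFq))

    |GFq|≡q : length GFq ≡ q
    |GFq|≡q = *-self-injective (≡.trans (≡.sym (length-cartesianProductWith a+bε GFq GFq))
                              (≡.trans (xs↭ys⇒|xs|≡|ys| products↭elems)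
                              (≡.trans |F|≡q² (≡.cong (q ℕ.*_) (ℕ.*-identityʳ q)))))

    GFq* : List Carrier
    GFq* = filter nonzero? GFq

    ∈-GFq*⁺ : ∀ {x} → InGFq x → x ≉ 0# → x ∈ GFq*
    ∈-GFq*⁺ x∈GFq x≉0 = ∈-filter⁺ setoid nonzero? ≉-respˡ (∈-GFq⁺ x∈GFq) x≉0

    ∈-GFq*⁻ : ∀ {x} → x ∈ GFq* → InGFq x × x ≉ 0#
    ∈-GFq*⁻ x∈ = let x∈GFq , x≉0 = ∈-filter⁻ setoid nonzero? ≉-respˡ {xs = GFq} x∈ in ∈-GFq⁻ x∈GFq , x≉0

    GFq*-unique : Unique GFq*
    GFq*-unique = filter⁺ setoid nonzero? GFq-unique

    |GFq*|≡q-1 : length GFq* ≡ q ℕ.∸ 1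
    |GFq*|≡q-1 = ≡.cong (ℕ._∸ 1) (≡.trans (≡.sym (xs↭ys⇒|xs|≡|ys| (↭-0∷filter-nonzero GFq-unique (∈-GFq⁺ conj-0)))) |GFq|≡q)

  module TwoLines (γ₁ γ₂ : Carrier) (γ₁≉0 : γ₁ ≉ 0#) (γ₂≉0 : γ₂ ≉ 0#)
                  (ε≉0 : γ₁ * conj γ₂ - conj γ₁ * γ₂ ≉ 0#) where

    ε : Carrier
    ε = γ₁ * conj γ₂ - conj γ₁ * γ₂

    ε̄≈-ε : conj ε ≈ - ε
    ε̄≈-ε = begin
      conj (γ₁ * conj γ₂ - conj γ₁ * γ₂)                       ≈⟨ conj-- _ _ ⟩
      conj (γ₁ * conj γ₂) - conj (conj γ₁ * γ₂)                ≈⟨ +-cong (conj-* _ _) (-‿cong (conj-* _ _)) ⟩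
      conj γ₁ * conj (conj γ₂) - conj (conj γ₁) * conj γ₂      ≈⟨ +-cong (*-congˡ (conj-involutive γ₂)) (-‿cong (*-congʳ (conj-involutive γ₁))) ⟩
      conj γ₁ * γ₂ - γ₁ * conj γ₂                              ≈⟨ solve 4 (λ a b a′ b′ → a′ :* b :- a :* b′ := :- (a :* b′ :- a′ :* b)) refl γ₁ γ₂ (conj γ₁) (conj γ₂) ⟩
      - ε                                                      ∎

    open Imaginary ε ε≉0 ε̄≈-ε
    module L₁ = Line γ₁ γ₁≉0
    module L₂ = Line γ₂ γ₂≉0

    N₁ N₂ : Carrier
    N₁ = L₁.N
    N₂ = L₂.N

    t₁ t₂ w₁ w₂ : Carrier → Carrier
    t₁ x = γ₁ * conj x + conj γ₁ * x
    t₂ x = γ₂ * conj x + conj γ₂ * x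
    w₁ x = γ₁ * conj x - conj γ₁ * x
    w₂ x = γ₂ * conj x - conj γ₂ * x

    centre : Carrier → Carrier → Carrier
    centre a₁ a₂ = (a₂ * γ₁ - a₁ * γ₂) * ε ⁻¹

    t₁-resp : ∀ {x y} → x ≈ y → t₁ x ≈ t₁ y
    t₁-resp x≈y = +-cong (*-congˡ (conj-cong x≈y)) (*-congˡ x≈y)

    t₂-resp : ∀ {x y} → x ≈ y → t₂ x ≈ t₂ y
    t₂-resp x≈y = +-cong (*-congˡ (conj-cong x≈y)) (*-congˡ x≈y)

    centre-cong : ∀ {a₁ a₂ a₁′ a₂′} → a₁ ≈ a₁′ → a₂ ≈ a₂′ → centre a₁ a₂ ≈ centre a₁′ a₂′
    centre-cong a₁≈ a₂≈ = *-congʳ (+-cong (*-congʳ a₂≈) (-‿cong (*-congʳ a₁≈)))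

    private
      conj-centre : ∀ {a₁ a₂} → InGFq a₁ → InGFq a₂ → conj (centre a₁ a₂) ≈ (a₂ * conj γ₁ - a₁ * conj γ₂) * - ε ⁻¹
      conj-centre {a₁} {a₂} a₁∈ a₂∈ = begin
        conj ((a₂ * γ₁ - a₁ * γ₂) * ε ⁻¹)              ≈⟨ conj-* _ _ ⟩
        conj (a₂ * γ₁ - a₁ * γ₂) * conj (ε ⁻¹)         ≈⟨ *-cong (conj-- _ _) (trans (conj-⁻¹ ε≉0) (trans (⁻¹-cong ε̄≈-ε) (-‿⁻¹ ε≉0))) ⟩
        (conj (a₂ * γ₁) - conj (a₁ * γ₂)) * - ε ⁻¹     ≈⟨ *-congʳ (+-cong (trans (conj-* _ _) (*-congʳ a₂∈)) (-‿cong (trans (conj-* _ _) (*-congʳ a₁∈)))) ⟩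
        (a₂ * conj γ₁ - a₁ * conj γ₂) * - ε ⁻¹         ∎

    t₁-centre : ∀ {a₁ a₂} → InGFq a₁ → InGFq a₂ → t₁ (centre a₁ a₂) ≈ a₁
    t₁-centre {a₁} {a₂} a₁∈ a₂∈ = begin
      γ₁ * conj (centre a₁ a₂) + conj γ₁ * centre a₁ a₂       ≈⟨ +-congʳ (*-congˡ (conj-centre a₁∈ a₂∈)) ⟩
      γ₁ * ((a₂ * conj γ₁ - a₁ * conj γ₂) * - ε ⁻¹) + conj γ₁ * ((a₂ * γ₁ - a₁ * γ₂) * ε ⁻¹)
        ≈⟨ solve 7 (λ g₁ g₂ g₁′ g₂′ a₁ a₂ e′ → g₁ :* ((a₂ :* g₁′ :- a₁ :* g₂′) :* (:- e′)) :+ g₁′ :* ((a₂ :* g₁ :- a₁ :* g₂) :* e′)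
                                            := a₁ :* ((g₁ :* g₂′ :- g₁′ :* g₂) :* e′)) refl γ₁ γ₂ (conj γ₁) (conj γ₂) a₁ a₂ (ε ⁻¹) ⟩
      a₁ * (ε * ε ⁻¹)   ≈⟨ *-congˡ (x*x⁻¹≈1 ε≉0) ⟩
      a₁ * 1#           ≈⟨ *-identityʳ a₁ ⟩
      a₁                ∎

    t₂-centre : ∀ {a₁ a₂} → InGFq a₁ → InGFq a₂ → t₂ (centre a₁ a₂) ≈ a₂
    t₂-centre {a₁} {a₂} a₁∈ a₂∈ = begin
      γ₂ * conj (centre a₁ a₂) + conj γ₂ * centre a₁ a₂       ≈⟨ +-congʳ (*-congˡ (conj-centre a₁∈ a₂∈)) ⟩
      γ₂ * ((a₂ * conj γ₁ - a₁ * conj γ₂) * - ε ⁻¹) + conj γ₂ * ((a₂ * γ₁ - a₁ * γ₂) * ε ⁻¹)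
        ≈⟨ solve 7 (λ g₁ g₂ g₁′ g₂′ a₁ a₂ e′ → g₂ :* ((a₂ :* g₁′ :- a₁ :* g₂′) :* (:- e′)) :+ g₂′ :* ((a₂ :* g₁ :- a₁ :* g₂) :* e′)
                                            := a₂ :* ((g₁ :* g₂′ :- g₁′ :* g₂) :* e′)) refl γ₁ γ₂ (conj γ₁) (conj γ₂) a₁ a₂ (ε ⁻¹) ⟩
      a₂ * (ε * ε ⁻¹)   ≈⟨ *-congˡ (x*x⁻¹≈1 ε≉0) ⟩
      a₂ * 1#           ≈⟨ *-identityʳ a₂ ⟩
      a₂                ∎

    centre-t : ∀ x → x ≈ centre (t₁ x) (t₂ x)
    centre-t x = sym (begin
      (t₂ x * γ₁ - t₁ x * γ₂) * ε ⁻¹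
        ≈⟨ *-congʳ (solve 6 (λ g₁ g₂ g₁′ g₂′ x x′ → (g₂ :* x′ :+ g₂′ :* x) :* g₁ :- (g₁ :* x′ :+ g₁′ :* x) :* g₂
                                                := (g₁ :* g₂′ :- g₁′ :* g₂) :* x) refl γ₁ γ₂ (conj γ₁) (conj γ₂) x (conj x)) ⟩
      ε * x * ε ⁻¹       ≈⟨ solve 3 (λ e x e′ → e :* x :* e′ := x :* (e :* e′)) refl ε x (ε ⁻¹) ⟩
      x * (ε * ε ⁻¹)     ≈⟨ *-congˡ (x*x⁻¹≈1 ε≉0) ⟩
      x * 1#             ≈⟨ *-identityʳ x ⟩
      x                  ∎)

    ε*x≈γ₂w₁-γ₁w₂ : ∀ x → ε * x ≈ γ₂ * w₁ x - γ₁ * w₂ x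
    ε*x≈γ₂w₁-γ₁w₂ x = solve 6 (λ g₁ g₂ g₁′ g₂′ x x′ → (g₁ :* g₂′ :- g₁′ :* g₂) :* x
                                                := g₂ :* (g₁ :* x′ :- g₁′ :* x) :- g₁ :* (g₂ :* x′ :- g₂′ :* x))
                                refl γ₁ γ₂ (conj γ₁) (conj γ₂) x (conj x)

    BothConditions : (c r : Carrier) → InGFq r → Set ℓ
    BothConditions c r r∈GFq = L₁.Meeting.TangencyCondition c r r∈GFq × L₂.Meeting.TangencyCondition c r r∈GFq

    same-centre : ∀ {c r c′ r′} (r∈GFq : InGFq r) (r′∈GFq : InGFq r′) →
                  BothConditions c r r∈GFq → BothConditions c′ r′ r′∈GFq → SameSet (B¹ c r) (B¹ c′ r′) → c ≈ c′
    same-centre {c} {r} {c′} {r′} r∈GFq r′∈GFq (tc₁ , tc₂) (tc₁′ , tc₂′) same = *-cancelˡ ε≉0 (begin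
      ε * c                    ≈⟨ ε*x≈γ₂w₁-γ₁w₂ c ⟩
      γ₂ * w₁ c - γ₁ * w₂ c    ≈⟨ +-cong (*-congˡ (L₁.w-determined r∈GFq r′∈GFq tc₁ tc₁′ same))
                                         (-‿cong (*-congˡ (L₂.w-determined r∈GFq r′∈GFq tc₂ tc₂′ same))) ⟩
      γ₂ * w₁ c′ - γ₁ * w₂ c′  ≈⟨ ε*x≈γ₂w₁-γ₁w₂ c′ ⟨
      ε * c′                   ∎)

    B¹-cong : ∀ {c r c′ r′} → c ≈ c′ → r ≈ r′ → SameSet (B¹ c r) (B¹ c′ r′)
    B¹-cong c≈c′ r≈r′ (just z) =
      (λ on → trans (sym (same-product c≈c′)) (trans on r≈r′)) , (λ on → trans (same-product c≈c′) (trans on (sym r≈r′)))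
      where
      same-product : ∀ {c c′} → c ≈ c′ → (z - c) * (conj z - conj c) ≈ (z - c′) * (conj z - conj c′)
      same-product c≈c′ = *-cong (+-congˡ (-‿cong c≈c′)) (+-congˡ (-‿cong (conj-cong c≈c′)))
    B¹-cong c≈c′ r≈r′ nothing = (λ ()) , (λ ())

    TangentToBoth : Circle → Set (c ⊔ ℓ)
    TangentToBoth C = IsFirstType C × Tangent ⟦ C ⟧ (B² γ₁ 0#) × Tangent ⟦ C ⟧ (B² γ₂ 0#)

    -- B¹(c, r) as a circle, with the junk value B¹(0, 1) unless r ∈ GF(q) ∖ {0}
    circle : Carrier → Carrier → Circle
    circle c r with InGFq? r | r ≟ 0#
    ... | yes r∈GFq | no r≉0 = first c r r∈GFq r≉0
    ... | _         | _      = first 0# 1# conj-1 1≉0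

    module _ {c r : Carrier} (r∈GFq : InGFq r) (r≉0 : r ≉ 0#) where

      ⟦circle⟧ : ⟦ circle c r ⟧ ≡ B¹ c r
      ⟦circle⟧ with InGFq? r | r ≟ 0#
      ... | yes _      | no _    = ≡.refl
      ... | yes _      | yes r≈0 = ⊥-elim (r≉0 r≈0)
      ... | no r∉GFq   | _       = ⊥-elim (r∉GFq r∈GFq)

      circle-tangentToBoth : BothConditions c r r∈GFq → TangentToBoth (circle c r)
      circle-tangentToBoth (tc₁ , tc₂) with InGFq? r | r ≟ 0#
      ... | yes r∈GFq′ | no _    = tt , L₁.Meeting.tangent c r r∈GFq′ tc₁ , L₂.Meeting.tangent c r r∈GFq′ tc₂
      ... | yes _      | yes r≈0 = ⊥-elim (r≉0 r≈0)
      ... | no r∉GFq   | _       = ⊥-elim (r∉GFq r∈GFq)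

    circleSetoid : Setoid (c ⊔ ℓ) (c ⊔ ℓ)
    circleSetoid = record
      { Carrier       = Circle
      ; _≈_           = SameCircle
      ; isEquivalence = record
        { refl  = λ _ → id , id
        ; sym   = λ C≈D P → swap (C≈D P)
        ; trans = λ C≈D D≈E P → proj₁ (D≈E P) ∘ proj₁ (C≈D P) , proj₂ (C≈D P) ∘ proj₂ (D≈E P)
        }
      }

    module Square (y : Carrier) (y²≈γ₁γ₂ : y * y ≈ γ₁ * γ₂) where

      -- k² = N₁ / N₂, since N(y)² = N(y²) = N(γ₁ γ₂) = N₁ N₂
      k : Carrier
      k = y * conj y * N₂ ⁻¹

      Ny²≈N₁N₂ : (y * conj y) * (y * conj y) ≈ N₁ * N₂
      Ny²≈N₁N₂ = begin
        (y * conj y) * (y * conj y)      ≈⟨ solve 2 (λ y y′ → (y :* y′) :* (y :* y′) := (y :* y) :* (y′ :* y′)) refl y (conj y) ⟩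
        (y * y) * (conj y * conj y)      ≈⟨ *-cong y²≈γ₁γ₂ (sym (conj-* y y)) ⟩
        (γ₁ * γ₂) * conj (y * y)         ≈⟨ *-congˡ (trans (conj-cong y²≈γ₁γ₂) (conj-* γ₁ γ₂)) ⟩
        (γ₁ * γ₂) * (conj γ₁ * conj γ₂)  ≈⟨ solve 4 (λ a b a′ b′ → (a :* b) :* (a′ :* b′) := (a :* a′) :* (b :* b′)) refl γ₁ γ₂ (conj γ₁) (conj γ₂) ⟩
        N₁ * N₂                          ∎

      k∈GFq : InGFq k
      k∈GFq = InGFq-* (InGFq-norm y) (InGFq-⁻¹ L₂.N≉0 L₂.N∈GFq)

      k≉0 : k ≉ 0#
      k≉0 = *-≉0 Ny≉0 (⁻¹-≉0 L₂.N≉0)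
        where
        Ny≉0 : y * conj y ≉ 0#
        Ny≉0 Ny≈0 = *-≉0 L₁.N≉0 L₂.N≉0 (trans (sym Ny²≈N₁N₂) (trans (*-congʳ Ny≈0) (zeroˡ _)))

      k²N₂≈N₁ : k * k * N₂ ≈ N₁
      k²N₂≈N₁ = begin
        Ny * N₂ ⁻¹ * (Ny * N₂ ⁻¹) * N₂    ≈⟨ solve 3 (λ a i n → a :* i :* (a :* i) :* n := (a :* a) :* i :* (i :* n)) refl Ny (N₂ ⁻¹) N₂ ⟩
        (Ny * Ny) * N₂ ⁻¹ * (N₂ ⁻¹ * N₂)  ≈⟨ *-cong (*-congʳ Ny²≈N₁N₂) (x⁻¹*x≈1 L₂.N≉0) ⟩
        (N₁ * N₂) * N₂ ⁻¹ * 1#            ≈⟨ solve 3 (λ a b i → (a :* b) :* i :* κ 1 := a :* (b :* i)) refl N₁ N₂ (N₂ ⁻¹) ⟩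
        N₁ * (N₂ * N₂ ⁻¹)                 ≈⟨ *-congˡ (x*x⁻¹≈1 L₂.N≉0) ⟩
        N₁ * 1#                           ≈⟨ *-identityʳ N₁ ⟩
        N₁                                ∎
        where
        Ny : Carrier
        Ny = y * conj y

      4N₂≉0 : fromℕ 4 * N₂ ≉ 0#
      4N₂≉0 = *-≉0 4≉0 L₂.N≉0

      radius : Carrier → Carrier
      radius a = a * a * (fromℕ 4 * N₂) ⁻¹

      radius-cong : ∀ {a b} → a ≈ b → radius a ≈ radius b
      radius-cong a≈b = *-congʳ (*-cong a≈b a≈b)

      radius∈GFq : ∀ {a} → InGFq a → InGFq (radius a)
      radius∈GFq a∈GFq = InGFq-* (InGFq-* a∈GFq a∈GFq) (InGFq-⁻¹ 4N₂≉0 (InGFq-* (InGFq-fromℕ 4) L₂.N∈GFq))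

      radius≉0 : ∀ {a} → a ≉ 0# → radius a ≉ 0#
      radius≉0 a≉0 = *-≉0 (*-≉0 a≉0 a≉0) (⁻¹-≉0 4N₂≉0)

      a²≈4N₂radius : ∀ a → a * a ≈ fromℕ 4 * (N₂ * radius a)
      a²≈4N₂radius a = sym (begin
        fromℕ 4 * (N₂ * (a * a * (fromℕ 4 * N₂) ⁻¹))   ≈⟨ solve 4 (λ f n a i → f :* (n :* (a :* i)) := a :* ((f :* n) :* i)) refl (fromℕ 4) N₂ (a * a) ((fromℕ 4 * N₂) ⁻¹) ⟩
        a * a * (fromℕ 4 * N₂ * (fromℕ 4 * N₂) ⁻¹)      ≈⟨ *-congˡ (x*x⁻¹≈1 4N₂≉0) ⟩
        a * a * 1#                                      ≈⟨ *-identityʳ _ ⟩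
        a * a                                           ∎)

      Root : Carrier → Set ℓ
      Root σ = InGFq σ × σ * σ ≈ k * k

      tangentCircle : Carrier → Carrier → Circle
      tangentCircle σ a = circle (centre (σ * a) a) (radius a)

      module _ {σ a : Carrier} (σ-root : Root σ) (a∈GFq : InGFq a) (a≉0 : a ≉ 0#) where

        t₁≈σa : t₁ (centre (σ * a) a) ≈ σ * a
        t₁≈σa = t₁-centre (InGFq-* (proj₁ σ-root) a∈GFq) a∈GFq

        t₂≈a : t₂ (centre (σ * a) a) ≈ a
        t₂≈a = t₂-centre (InGFq-* (proj₁ σ-root) a∈GFq) a∈GFq

        bothConditions : BothConditions (centre (σ * a) a) (radius a) (radius∈GFq a∈GFq)
        bothConditions = condition₁ , trans (*-cong t₂≈a t₂≈a) (a²≈4N₂radius a)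
          where
          condition₁ : t₁ (centre (σ * a) a) * t₁ (centre (σ * a) a) ≈ fromℕ 4 * (N₁ * radius a)
          condition₁ = begin
            t₁ (centre (σ * a) a) * t₁ (centre (σ * a) a)  ≈⟨ *-cong t₁≈σa t₁≈σa ⟩
            (σ * a) * (σ * a)                             ≈⟨ solve 2 (λ s a → (s :* a) :* (s :* a) := (s :* s) :* (a :* a)) refl σ a ⟩
            (σ * σ) * (a * a)                             ≈⟨ *-cong (proj₂ σ-root) (a²≈4N₂radius a) ⟩
            (k * k) * (fromℕ 4 * (N₂ * radius a))         ≈⟨ solve 4 (λ k² f n r → k² :* (f :* (n :* r)) := f :* ((k² :* n) :* r)) refl (k * k) (fromℕ 4) N₂ (radius a) ⟩
            fromℕ 4 * ((k * k * N₂) * radius a)           ≈⟨ *-congˡ (*-congʳ k²N₂≈N₁) ⟩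
            fromℕ 4 * (N₁ * radius a)                     ∎

        ⟦tangentCircle⟧ : ⟦ tangentCircle σ a ⟧ ≡ B¹ (centre (σ * a) a) (radius a)
        ⟦tangentCircle⟧ = ⟦circle⟧ (radius∈GFq a∈GFq) (radius≉0 a≉0)

        tangentCircle-tangentToBoth : TangentToBoth (tangentCircle σ a)
        tangentCircle-tangentToBoth = circle-tangentToBoth (radius∈GFq a∈GFq) (radius≉0 a≉0) bothConditions

      tangentCircle-injective : ∀ {σ σ′ a b} (σ-root : Root σ) (σ′-root : Root σ′) →
        (a∈GFq : InGFq a) (a≉0 : a ≉ 0#) (b∈GFq : InGFq b) (b≉0 : b ≉ 0#) →
        SameCircle (tangentCircle σ a) (tangentCircle σ′ b) → a ≈ b × σ ≈ σ′
      tangentCircle-injective {σ} {σ′} {a} {b} σ-root σ′-root a∈GFq a≉0 b∈GFq b≉0 same = a≈b , σ≈σ′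
        where
        centres≈ : centre (σ * a) a ≈ centre (σ′ * b) b
        centres≈ = same-centre (radius∈GFq a∈GFq) (radius∈GFq b∈GFq)
          (bothConditions σ-root a∈GFq a≉0) (bothConditions σ′-root b∈GFq b≉0)
          (≡.subst₂ SameSet (⟦tangentCircle⟧ σ-root a∈GFq a≉0) (⟦tangentCircle⟧ σ′-root b∈GFq b≉0) same)
        a≈b : a ≈ b
        a≈b = trans (sym (t₂≈a σ-root a∈GFq a≉0)) (trans (t₂-resp centres≈) (t₂≈a σ′-root b∈GFq b≉0))
        σa≈σ′b : σ * a ≈ σ′ * b
        σa≈σ′b = trans (sym (t₁≈σa σ-root a∈GFq a≉0)) (trans (t₁-resp centres≈) (t₁≈σa σ′-root b∈GFq b≉0))
        σ≈σ′ : σ ≈ σ′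
        σ≈σ′ = *-cancelˡ a≉0 (trans (*-comm a σ) (trans σa≈σ′b (trans (*-congˡ (sym a≈b)) (*-comm σ′ a))))

      k-root : Root k
      k-root = k∈GFq , refl

      -k-root : Root (- k)
      -k-root = InGFq‿- k∈GFq , solve 1 (λ k → (:- k) :* (:- k) := k :* k) refl k

      circles : List Circle
      circles = map (tangentCircle k) GFq* ++ map (tangentCircle (- k)) GFq*

      |circles|≡2[q-1] : length circles ≡ 2 ℕ.* (q ℕ.∸ 1)
      |circles|≡2[q-1] = ≡.trans (List.length-++ (map (tangentCircle k) GFq*))
        (≡.cong₂ ℕ._+_ (≡.trans (List.length-map _ GFq*) |GFq*|≡q-1)
                       (≡.trans (List.length-map _ GFq*) (≡.trans |GFq*|≡q-1 (≡.sym (ℕ.+-identityʳ _)))))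

      circles-tangentToBoth : All TangentToBoth circles
      circles-tangentToBoth = All.++⁺ (each k-root) (each -k-root)
        where
        each : ∀ {σ} → Root σ → All TangentToBoth (map (tangentCircle σ) GFq*)
        each σ-root = All.map⁺ (All.tabulateₛ setoid λ a∈ →
          let a∈GFq , a≉0 = ∈-GFq*⁻ a∈ in tangentCircle-tangentToBoth σ-root a∈GFq a≉0)

      circles-distinct : AllPairs (λ C D → ¬ SameCircle C D) circles
      circles-distinct = ++⁺ circleSetoid (distinct-for k-root) (distinct-for -k-root) (λ {C} → k≠-k {C})
        where
        distinct-for : ∀ {σ} → Root σ → AllPairs (λ C D → ¬ SameCircle C D) (map (tangentCircle σ) GFq*)
        distinct-for σ-root = Unique-map circleSetoid (tangentCircle _) GFq*-unique λ a∈ b∈ same →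
          let a∈GFq , a≉0 = ∈-GFq*⁻ a∈ ; b∈GFq , b≉0 = ∈-GFq*⁻ b∈ in
          proj₁ (tangentCircle-injective σ-root σ-root a∈GFq a≉0 b∈GFq b≉0 same)
        k≠-k : ∀ {C} → ¬ (Any (SameCircle C) (map (tangentCircle k) GFq*) × Any (SameCircle C) (map (tangentCircle (- k)) GFq*))
        k≠-k {C} (C∈₁ , C∈₂) with a , a∈ , C≈₁ ← ∈-map⁻ setoid circleSetoid {C} C∈₁ | b , b∈ , C≈₂ ← ∈-map⁻ setoid circleSetoid {C} C∈₂ =
          let a∈GFq , a≉0 = ∈-GFq*⁻ a∈ ; b∈GFq , b≉0 = ∈-GFq*⁻ b∈ in
          k≉0 (x≈-x⇒x≈0 2≉0 (proj₂ (tangentCircle-injective k-root -k-root a∈GFq a≉0 b∈GFq b≉0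
            (Setoid.trans circleSetoid {tangentCircle k a} {C} {tangentCircle (- k) b} (Setoid.sym circleSetoid {C} {tangentCircle k a} C≈₁) C≈₂))))

      circles-complete : ∀ C → TangentToBoth C → Any (SameCircle C) circles
      circles-complete (first c r r∈GFq r≉0) (_ , T₁ , T₂) =
        [ (λ t₁≈ka → Any.++⁺ˡ (member k-root t₁≈ka))
        , (λ t₁≈-ka → Any.++⁺ʳ (map (tangentCircle k) GFq*) (member -k-root (trans t₁≈-ka (-‿distribˡ-* k a))))
        ] (x*x≈y*y⇒x≈y⊎x≈-y t₁²≈[ka]²)
        where
        tc₁ : L₁.Meeting.TangencyCondition c r r∈GFq
        tc₁ = L₁.Meeting.tangent⇒tangencyCondition c r r∈GFq T₁
        tc₂ : L₂.Meeting.TangencyCondition c r r∈GFq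
        tc₂ = L₂.Meeting.tangent⇒tangencyCondition c r r∈GFq T₂
        a : Carrier
        a = t₂ c
        a∈GFq : InGFq a
        a∈GFq = L₂.Meeting.t∈GFq c r r∈GFq
        a≉0 : a ≉ 0#
        a≉0 a≈0 = *-≉0 4≉0 (*-≉0 L₂.N≉0 r≉0) (trans (sym tc₂) (trans (*-congʳ a≈0) (zeroˡ a)))
        t₁²≈[ka]² : t₁ c * t₁ c ≈ (k * a) * (k * a)
        t₁²≈[ka]² = begin
          t₁ c * t₁ c                      ≈⟨ tc₁ ⟩
          fromℕ 4 * (N₁ * r)               ≈⟨ *-congˡ (*-congʳ k²N₂≈N₁) ⟨
          fromℕ 4 * (k * k * N₂ * r)       ≈⟨ solve 4 (λ f k n r → f :* (k :* k :* n :* r) := (k :* k) :* (f :* (n :* r))) refl (fromℕ 4) k N₂ r ⟩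
          (k * k) * (fromℕ 4 * (N₂ * r))   ≈⟨ *-congˡ tc₂ ⟨
          (k * k) * (a * a)                ≈⟨ solve 2 (λ k a → (k :* k) :* (a :* a) := (k :* a) :* (k :* a)) refl k a ⟩
          (k * a) * (k * a)                ∎
        r≈radius : r ≈ radius a
        r≈radius = a*x≈b⇒x≈b*a⁻¹ 4N₂≉0 (trans (*-assoc _ _ _) (sym tc₂))
        member : ∀ {σ} → Root σ → t₁ c ≈ σ * a → Any (SameCircle (first c r r∈GFq r≉0)) (map (tangentCircle σ) GFq*)
        member {σ} σ-root t₁≈σa = Any.map⁺ (Any.map same (∈-GFq*⁺ a∈GFq a≉0))
          where
          same : ∀ {b} → a ≈ b → SameCircle (first c r r∈GFq r≉0) (tangentCircle σ b)
          same {b} a≈b = ≡.subst (SameSet (B¹ c r)) (≡.sym (⟦tangentCircle⟧ σ-root b∈GFq b≉0))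
            (B¹-cong (trans (centre-t c) (centre-cong (trans t₁≈σa (*-congˡ a≈b)) a≈b)) (trans r≈radius (radius-cong a≈b)))
            where
            b∈GFq : InGFq b
            b∈GFq = InGFq-cong a≈b a∈GFq
            b≉0 : b ≉ 0#
            b≉0 = ≉-respˡ a≈b a≉0

      exactly : ExactlyCircles (2 ℕ.* (q ℕ.∸ 1)) TangentToBoth
      exactly = circles , |circles|≡2[q-1] , circles-tangentToBoth , circles-distinct , circles-complete

    module Nonsquare (nonsquare : ¬ IsSquare (γ₁ * γ₂)) where

      private
        x : Carrier
        x = γ₁ * γ₂
        h : ℕ
        h = proj₁ (odd-^ (odd-prime p-prime p≢2) m)
        q≡1+2h : q ≡ suc (2 ℕ.* h)
        q≡1+2h = proj₂ (odd-^ (odd-prime p-prime p≢2) m)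

      -- A norm λ² with λ ∈ GF(q)^* makes x^((q+1)(q-1)/2) = λ^(q-1) = 1, against Euler's criterion.
      norm-not-square : ∀ {λ′} → InGFq λ′ → λ′ ≉ 0# → ¬ (x * conj x ≈ λ′ * λ′)
      norm-not-square {λ′} λ′∈GFq λ′≉0 x̄x≈λ² with k , 2k≡|F*| , xᵏ≈-1 ← euler 2≉0 nonsquare =
        1≉-1 2≉0 (trans (sym x^[[1+q]h]≈1) (trans (reflexive (≡.cong (x ^_) (≡.sym k≡[1+q]h))) xᵏ≈-1))
        where
        λ^2h≈1 : λ′ ^ (2 ℕ.* h) ≈ 1#
        λ^2h≈1 = *-cancelˡ λ′≉0 (begin
          λ′ * λ′ ^ (2 ℕ.* h)   ≡⟨ ≡.cong (λ′ ^_) (≡.sym q≡1+2h) ⟩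
          λ′ ^ q                ≈⟨ conj≈^q λ′ ⟨
          conj λ′               ≈⟨ λ′∈GFq ⟩
          λ′                    ≈⟨ *-identityʳ λ′ ⟨
          λ′ * 1#               ∎)
        x^[[1+q]h]≈1 : x ^ (suc q ℕ.* h) ≈ 1#
        x^[[1+q]h]≈1 = begin
          x ^ (suc q ℕ.* h)          ≈⟨ ^-assocʳ x (suc q) h ⟨
          (x * x ^ q) ^ h            ≈⟨ ^-congˡ h (*-congˡ (conj≈^q x)) ⟨
          (x * conj x) ^ h           ≈⟨ ^-congˡ h x̄x≈λ² ⟩
          (λ′ * λ′) ^ h              ≈⟨ ^-distrib-* λ′ λ′ h ⟩
          λ′ ^ h * λ′ ^ h            ≈⟨ ^-homo-* λ′ h h ⟨
          λ′ ^ (h ℕ.+ h)             ≡⟨ ≡.cong (λ′ ^_) (≡.cong (h ℕ.+_) (≡.sym (ℕ.+-identityʳ h))) ⟩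
          λ′ ^ (2 ℕ.* h)             ≈⟨ λ^2h≈1 ⟩
          1#                         ∎
        k≡[1+q]h : k ≡ suc q ℕ.* h
        k≡[1+q]h = ℕ.*-cancelˡ-≡ k (suc q ℕ.* h) 2 (ℕ.suc-injective
          (≡.trans (≡.cong suc 2k≡|F*|) (≡.trans (≡.sym |F|≡1+|F*|) (≡.trans |F|≡q²
          (≡.trans (≡.cong (q ℕ.*_) (ℕ.*-identityʳ q)) (odd-square {h = h} q≡1+2h))))))

      no-first-type : ∀ {c r} (r∈GFq : InGFq r) → r ≉ 0# → ¬ (Tangent (B¹ c r) (B² γ₁ 0#) × Tangent (B¹ c r) (B² γ₂ 0#))
      no-first-type {c} {r} r∈GFq r≉0 (T₁ , T₂) = norm-not-square λ∈GFq λ≉0 (begin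
        x * conj x                        ≈⟨ *-congˡ (conj-* γ₁ γ₂) ⟩
        (γ₁ * γ₂) * (conj γ₁ * conj γ₂)   ≈⟨ solve 4 (λ a b a′ b′ → (a :* b) :* (a′ :* b′) := (a :* a′) :* (b :* b′)) refl γ₁ γ₂ (conj γ₁) (conj γ₂) ⟩
        N₁ * N₂                           ≈⟨ λ²≈N₁N₂ ⟨
        λ′ * λ′                           ∎)
        where
        tc₁ : L₁.Meeting.TangencyCondition c r r∈GFq
        tc₁ = L₁.Meeting.tangent⇒tangencyCondition c r r∈GFq T₁
        tc₂ : L₂.Meeting.TangencyCondition c r r∈GFq
        tc₂ = L₂.Meeting.tangent⇒tangencyCondition c r r∈GFq T₂
        4r≉0 : fromℕ 4 * r ≉ 0#
        4r≉0 = *-≉0 4≉0 r≉0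
        λ′ : Carrier
        λ′ = t₁ c * t₂ c * (fromℕ 4 * r) ⁻¹
        λ²≈N₁N₂ : λ′ * λ′ ≈ N₁ * N₂
        λ²≈N₁N₂ = begin
          λ′ * λ′
            ≈⟨ solve 3 (λ a b i → a :* b :* i :* (a :* b :* i) := (a :* a) :* (b :* b) :* (i :* i)) refl (t₁ c) (t₂ c) ((fromℕ 4 * r) ⁻¹) ⟩
          (t₁ c * t₁ c) * (t₂ c * t₂ c) * ((fromℕ 4 * r) ⁻¹ * (fromℕ 4 * r) ⁻¹)
            ≈⟨ *-congʳ (*-cong tc₁ tc₂) ⟩
          (fromℕ 4 * (N₁ * r)) * (fromℕ 4 * (N₂ * r)) * ((fromℕ 4 * r) ⁻¹ * (fromℕ 4 * r) ⁻¹)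
            ≈⟨ solve 5 (λ f n₁ n₂ r i → (f :* (n₁ :* r)) :* (f :* (n₂ :* r)) :* (i :* i) := (n₁ :* n₂) :* (((f :* r) :* i) :* ((f :* r) :* i))) refl (fromℕ 4) N₁ N₂ r ((fromℕ 4 * r) ⁻¹) ⟩
          (N₁ * N₂) * ((fromℕ 4 * r * (fromℕ 4 * r) ⁻¹) * (fromℕ 4 * r * (fromℕ 4 * r) ⁻¹))
            ≈⟨ *-congˡ (*-cong (x*x⁻¹≈1 4r≉0) (x*x⁻¹≈1 4r≉0)) ⟩
          (N₁ * N₂) * (1# * 1#)
            ≈⟨ trans (*-congˡ (*-identityˡ 1#)) (*-identityʳ _) ⟩
          N₁ * N₂ ∎
        λ∈GFq : InGFq λ′
        λ∈GFq = InGFq-* (InGFq-* (L₁.Meeting.t∈GFq c r r∈GFq) (L₂.Meeting.t∈GFq c r r∈GFq))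
                        (InGFq-⁻¹ 4r≉0 (InGFq-* (InGFq-fromℕ 4) r∈GFq))
        λ≉0 : λ′ ≉ 0#
        λ≉0 λ≈0 = *-≉0 L₁.N≉0 L₂.N≉0 (trans (sym λ²≈N₁N₂) (trans (*-congʳ λ≈0) (zeroˡ _)))

      -- B²(γ′, r′) would be parallel to both lines, forcing γ̄′ ε = 0.
      no-second-type : ∀ {γ′ r′} → γ′ ≉ 0# → InGFq r′ → ¬ (Tangent (B² γ′ r′) (B² γ₁ 0#) × Tangent (B² γ′ r′) (B² γ₂ 0#))
      no-second-type {γ′} {r′} γ′≉0 r′∈GFq (T₁ , T₂) = conj-≉0 γ′≉0 (*-cancelˡ ε≉0 (begin
        ε * conj γ′
          ≈⟨ solve 6 (λ g₁ g₂ g₁′ g₂′ a a′ → (g₁ :* g₂′ :- g₁′ :* g₂) :* a′ := g₂′ :* (a′ :* g₁ :- a :* g₁′) :- g₁′ :* (a′ :* g₂ :- a :* g₂′)) refl γ₁ γ₂ (conj γ₁) (conj γ₂) γ′ (conj γ′) ⟩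
        conj γ₂ * (conj γ′ * γ₁ - γ′ * conj γ₁) - conj γ₁ * (conj γ′ * γ₂ - γ′ * conj γ₂)
          ≈⟨ +-cong (*-congˡ (L₁.tangent-B²⇒parallel r′∈GFq T₁)) (-‿cong (*-congˡ (L₂.tangent-B²⇒parallel r′∈GFq T₂))) ⟩
        conj γ₂ * 0# - conj γ₁ * 0#
          ≈⟨ solve 2 (λ a b → a :* κ 0 :- b :* κ 0 := κ 0) refl (conj γ₂) (conj γ₁) ⟩
        0#        ≈⟨ zeroʳ ε ⟨
        ε * 0#    ∎))

      no-tangent-circle : ∀ C → ¬ (Tangent ⟦ C ⟧ (B² γ₁ 0#) × Tangent ⟦ C ⟧ (B² γ₂ 0#))
      no-tangent-circle (first _ _ r∈GFq r≉0)   = no-first-type r∈GFq r≉0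
      no-tangent-circle (second _ _ γ′≉0 r′∈GFq) = no-second-type γ′≉0 r′∈GFq

open import Data.Nat using (_^_; _≤_) renaming (_*_ to _*ℕ_)

lemma4p1 : ∀ {c ℓ} (F : FiniteField c ℓ) (p m : ℕ) → Prime p → ¬ (p ≡ 2) → 1 ≤ m →
    length (FiniteField.elems F) ≡ (p ^ m) ^ 2 →
    let open FiniteField F
        open Plane F (p ^ m)
    in (γ₁ γ₂ : Carrier) → ¬ (γ₁ ≈ 0#) → ¬ (γ₂ ≈ 0#) →
       ¬ (γ₁ * conj γ₂ - conj γ₁ * γ₂ ≈ 0#) →
       (IsSquare (γ₁ * γ₂) →
          ExactlyCircles (2 *ℕ (p ^ m ∸ 1))
            (λ C → IsFirstType C × Tangent ⟦ C ⟧ (B² γ₁ 0#) × Tangent ⟦ C ⟧ (B² γ₂ 0#)))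
       × (¬ IsSquare (γ₁ * γ₂) →
          (C : Circle) → ¬ (Tangent ⟦ C ⟧ (B² γ₁ 0#) × Tangent ⟦ C ⟧ (B² γ₂ 0#)))
lemma4p1 F p m p-prime p≢2 _ |F|≡q² γ₁ γ₂ γ₁≉0 γ₂≉0 ε≉0 =
  (λ (y , y²≈γ₁γ₂) → Square.exactly y y²≈γ₁γ₂) , Nonsquare.no-tangent-circle
  where open QuadraticExtension.TwoLines F {p} {m} p-prime p≢2 |F|≡q² γ₁ γ₂ γ₁≉0 γ₂≉0 ε≉0
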